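{- Let $n\ge2$ be even and $x\in C^n_1$. Then for every $1\le i\le n-2$, the simple reflections $s_i$ and $s_{i+1}$ do not both belong to $\tau_{\mathbf m}(x)$.
   Context: $S_n$ symmetric group, $s_i=(i,i+1)$, $S=\{s_1,\dots,s_{n-1}\}$, $\ell$ length, $\mathcal F_n$ fixed-point-free involutions with Bruhat order the weakest partial order with $z\le tzt$ for transpositions $t$ with $\ell(z)\le\ell(tzt)$; $\tau_{\mathbf m}(z)=\{s\in S:szs\le z\}$. Graph: $\mathcal M$ free $\mathbb Z[v,v^{ -1}]$-module with basis $M_z$ ($z\in\mathcal F_n$), Hecke-module via $H_sM_z=M_{szs}$ if $\ell(szs)>\ell(z)$, $M_{szs}+(v-v^{ -1})M_z$ if $\ell(szs)<\ell(z)$, $vM_z$ if $szs=z$; unique compatible bar involution fixing $M_{s_1s_3\cdots s_{n-1}}$; canonical basis $\underline M_z=\overline{\underline M_z}\in M_z+\sum_{w<z}v^{ -1}\mathbb Z[v^{ -1}]M_w$, $\underline M_z=\sum m_{w,z}M_w$, $\mu_{\mathbf m}(w,z)$ the $v^{ -1}$-coefficient of $m_{w,z}$; $\omega_{\mathbf m}(x\to y)=\mu_{\mathbf m}(x,y)+\mu_{\mathbf m}(y,x)$ if $\tau_{\mathbf m}(x)\not\subseteq\tau_{\mathbf m}(y)$, else $0$. Bidirected edge between $x\ne y$: both $\omega_{\mathbf m}(x\to y),\omega_{\mathbf m}(y\to x)$ nonzero; molecules are connected components of the graph of bidirected edges. $C^n_1$ is the molecule containing $s_1s_3\cdots s_{n-1}$.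 -}

module Defs where

open import Data.Nat using (ℕ; zero; suc; _≤_; _<_)
open import Data.Nat.Properties using ()
open import Data.Integer using (ℤ; +_; -[1+_]; _+_; _-_; -_) renaming (_<_ to _<ℤ_; _≤_ to _≤ℤ_)
open import Data.Fin using (Fin; toℕ)
open import Data.Fin.Properties using (_≟_)
open import Data.Vec using (Vec; lookup; tabulate)
open import Data.Vec.Properties using (lookup∘tabulate)
import Data.Vec.Properties as VP
open import Data.List using (List; map; allFin)
open import Data.Nat.ListAction using (sum)
open import Data.Bool using (Bool; true; false; if_then_else_; _∧_)
open import Data.Nat using (_<ᵇ_)
open import Data.Product using (Σ; ∃; _×_; _,_)
open import Data.Empty using (⊥)
open import Relation.Nullary using (¬_; yes; no; Dec)
open import Relation.Nullary.Decidable using (⌊_⌋)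
open import Relation.Binary.PropositionalEquality
open import Relation.Binary.Construct.Closure.ReflexiveTransitive using (Star)

-- Transpositions of {0,…,n-1}  (0-indexed model of {1,…,n})

swap : ∀ {n} → Fin n → Fin n → Fin n → Fin n
swap a b i with i ≟ a
... | yes _ = b
... | no _ with i ≟ b
...   | yes _ = a
...   | no _ = i

swap-invol : ∀ {n} (a b i : Fin n) → swap a b (swap a b i) ≡ i
swap-invol a b i with i ≟ a
swap-invol a b i | yes i≡a with b ≟ a
... | yes b≡a = trans b≡a (sym i≡a)
... | no _ with b ≟ b
...   | yes _ = sym i≡a
...   | no b≢b = ⊥-elim′ (b≢b refl)
  where ⊥-elim′ : ∀ {A : Set} → ⊥ → A
        ⊥-elim′ ()
swap-invol a b i | no i≢a with i ≟ b
swap-invol a b i | no i≢a | yes i≡b with a ≟ a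
... | yes _ = sym i≡b
... | no a≢a = ⊥-elim′ (a≢a refl)
  where ⊥-elim′ : ∀ {A : Set} → ⊥ → A
        ⊥-elim′ ()
swap-invol a b i | no i≢a | no i≢b with i ≟ a
... | yes i≡a = ⊥-elim′ (i≢a i≡a)
  where ⊥-elim′ : ∀ {A : Set} → ⊥ → A
        ⊥-elim′ ()
... | no _ with i ≟ b
...   | yes i≡b = ⊥-elim′ (i≢b i≡b)
  where ⊥-elim′ : ∀ {A : Set} → ⊥ → A
        ⊥-elim′ ()
...   | no _ = refl

-- Fixed-point-free involutions in S_n, stored as a vector of images.
-- The proof fields are irrelevant, so two elements are equal iff their
-- image vectors are equal.

record Fpf (n : ℕ) : Set where
  constructor mkFpf
  field
    perm : Vec (Fin n) n
    .invol : ∀ i → lookup perm (lookup perm i) ≡ i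
    .fpf   : ∀ i → ¬ (lookup perm i ≡ i)
open Fpf public

app : ∀ {n} → Fpf n → Fin n → Fin n
app z i = lookup (perm z) i

module _ {n : ℕ} (a b : Fin n) (p : Vec (Fin n) n) where
  private
    t = swap a b
    f : Fin n → Fin n
    f i = t (lookup p (t i))
    lt : ∀ i → lookup (tabulate f) i ≡ f i
    lt = lookup∘tabulate f

  conj-invol : (∀ i → lookup p (lookup p i) ≡ i) →
               ∀ i → lookup (tabulate f) (lookup (tabulate f) i) ≡ i
  conj-invol zinv i = begin
      lookup (tabulate f) (lookup (tabulate f) i)
        ≡⟨ cong (lookup (tabulate f)) (lt i) ⟩
      lookup (tabulate f) (f i)
        ≡⟨ lt (f i) ⟩
      t (lookup p (t (t (lookup p (t i)))))
        ≡⟨ cong (λ k → t (lookup p k)) (swap-invol a b (lookup p (t i))) ⟩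
      t (lookup p (lookup p (t i)))
        ≡⟨ cong t (zinv (t i)) ⟩
      t (t i)
        ≡⟨ swap-invol a b i ⟩
      i ∎
    where open ≡-Reasoning

  conj-fpf : (∀ i → ¬ (lookup p i ≡ i)) → ∀ i → ¬ (lookup (tabulate f) i ≡ i)
  conj-fpf zfpf i eq = zfpf (t i)
    (trans (sym (swap-invol a b (lookup p (t i)))) (cong t (trans (sym (lt i)) eq)))

conj : ∀ {n} → Fin n → Fin n → Fpf n → Fpf n
conj a b (mkFpf p zinv zfpf) =
  mkFpf (tabulate (λ i → swap a b (lookup p (swap a b i))))
        (conj-invol a b p zinv) (conj-fpf a b p zfpf)

len : ∀ {n} → Fpf n → ℕ
len {n} z = sum (map (λ i → sum (map (λ j → inv? i j) (allFin n))) (allFin n))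
  where
  inv? : Fin n → Fin n → ℕ
  inv? i j = if (toℕ i <ᵇ toℕ j) ∧ (toℕ (app z j) <ᵇ toℕ (app z i)) then 1 else 0

-- s = (a b) is a simple reflection s_k : a = k-1, b = k (0-indexed)
IsSimple : ∀ {n} → Fin n → Fin n → Set
IsSimple a b = toℕ b ≡ suc (toℕ a)

-- Bruhat order on F_n: the weakest partial order with z ≤ tzt whenever
-- t is a transposition with ℓ(z) ≤ ℓ(tzt); i.e. the reflexive-transitive
-- closure of the covering-type relation below.

BruhatStep : ∀ {n} → Fpf n → Fpf n → Set
BruhatStep z w = Σ _ λ a → Σ _ λ b → ¬ (a ≡ b) × (w ≡ conj a b z) × (len z ≤ len w)

_≤B_ : ∀ {n} → Fpf n → Fpf n → Set
_≤B_ = Star BruhatStep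

_<B_ : ∀ {n} → Fpf n → Fpf n → Set
w <B z = (w ≤B z) × ¬ (w ≡ z)

InTau : ∀ {n} → Fpf n → Fin n → Fin n → Set
InTau z a b = conj a b z ≤B z

TauSub : ∀ {n} → Fpf n → Fpf n → Set
TauSub {n} x y = (a b : Fin n) → IsSimple a b → InTau x a b → InTau y a b

-- The module M.  An element is given by its coefficients:
-- f w k = coefficient of v^k M_w.

Mod : ℕ → Set
Mod n = Fpf n → ℤ → ℤ

_≐_ : ∀ {n} → Mod n → Mod n → Set
f ≐ g = ∀ w k → f w k ≡ g w k

_⊕_ : ∀ {n} → Mod n → Mod n → Mod n
(f ⊕ g) w k = f w k + g w k

vmul : ∀ {n} → Mod n → Mod n
vmul f w k = f w (k - + 1)

vinvmul : ∀ {n} → Mod n → Mod n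
vinvmul f w k = f w (k + + 1)

basis : ∀ {n} → Fpf n → Mod n
basis z w k with VP.≡-dec _≟_ (perm w) (perm z) | k Data.Integer.≟ + 0
... | yes _ | yes _ = + 1
... | _     | _     = + 0

fixedBy : ∀ {n} → Fin n → Fin n → Fpf n → Bool
fixedBy a b w = ⌊ VP.≡-dec _≟_ (perm (conj a b w)) (perm w) ⌋

-- Action of H_s, s = (a b), on M (coefficientwise form of
--   H_s M_z = M_{szs}                    if ℓ(szs) > ℓ(z)
--           = M_{szs} + (v - v⁻¹) M_z     if ℓ(szs) < ℓ(z)
--           = v M_z                       if szs = z )
hecke : ∀ {n} → Fin n → Fin n → Mod n → Mod n
hecke a b f w k =
  if fixedBy a b w
  then f w (k - + 1)
  else (f (conj a b w) k
        + (if len (conj a b w) <ᵇ len w then f w (k - + 1) - f w (k + + 1) else + 0))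

-- Action of bar(H_s) = H_s⁻¹ = H_s - (v - v⁻¹)
heckeInv : ∀ {n} → Fin n → Fin n → Mod n → Mod n
heckeInv a b f w k = hecke a b f w k - f w (k - + 1) + f w (k + + 1)

-- s_1 s_3 ⋯ s_{n-1} : 0 ↔ 1, 2 ↔ 3, … (0-indexed)

partner : ℕ → ℕ
partner zero = 1
partner (suc zero) = 0
partner (suc (suc k)) = suc (suc (partner k))

IsBase : ∀ {n} → Fpf n → Set
IsBase {n} z0 = (i : Fin n) → toℕ (app z0 i) ≡ partner (toℕ i)

record IsBarInvolution {n} (z0 : Fpf n) (ψ : Mod n → Mod n) : Set where
  field
    respects : ∀ f g → f ≐ g → ψ f ≐ ψ g
    additive : ∀ f g → ψ (f ⊕ g) ≐ (ψ f ⊕ ψ g)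
    semilin  : ∀ f → ψ (vmul f) ≐ vinvmul (ψ f)
    compat   : ∀ a b → IsSimple a b → ∀ f → ψ (hecke a b f) ≐ heckeInv a b (ψ f)
    involutive : ∀ f → ψ (ψ f) ≐ f
    fixesBase : ψ (basis z0) ≐ basis z0

-- The canonical basis: underline-M_z = bar-invariant, in
-- M_z + Σ_{w<z} v⁻¹ℤ[v⁻¹] M_w.   cb z w k = coefficient of v^k in m_{w,z}.
record IsCanonicalBasis {n} (ψ : Mod n → Mod n) (cb : Fpf n → Mod n) : Set where
  field
    barInvariant : ∀ z → ψ (cb z) ≐ cb z
    diagonal     : ∀ z k → cb z z k ≡ basis z z k
    negDegrees   : ∀ z w → ¬ (w ≡ z) → ∀ k → + 0 ≤ℤ k → cb z w k ≡ + 0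
    polynomial   : ∀ z w → ∃ λ (B : ℕ) → ∀ k → k <ℤ -[1+ B ] → cb z w k ≡ + 0
    support      : ∀ z w → ¬ (w ≤B z) → ∀ k → cb z w k ≡ + 0

μ : ∀ {n} → (Fpf n → Mod n) → Fpf n → Fpf n → ℤ
μ cb w z = cb z w -[1+ 0 ]

-- ω_m(x → y) ≠ 0  (ω is μ(x,y)+μ(y,x) if τ(x) ⊄ τ(y), else 0)
ωNonzero : ∀ {n} → (Fpf n → Mod n) → Fpf n → Fpf n → Set
ωNonzero cb x y = ¬ (TauSub x y) × ¬ (μ cb x y + μ cb y x ≡ + 0)

BiEdge : ∀ {n} → (Fpf n → Mod n) → Fpf n → Fpf n → Set
BiEdge cb x y = ¬ (x ≡ y) × ωNonzero cb x y × ωNonzero cb y x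

InMolecule : ∀ {n} → (Fpf n → Mod n) → Fpf n → Fpf n → Set
InMolecule cb z0 x = Star (BiEdge cb) z0 x

{-# OPTIONS --safe #-}
-- In the 0-indexed encoding, s = (a a+1) lies in τ(z) iff z(a+1) < z(a): conjugating by s
-- changes the number of inversions by exactly 2 unless z swaps a and a+1.  Call z non-nesting
-- if it has no arcs i < j < z j < z i.  A non-nesting z cannot descend at both a and a+1, for
-- then the arc at a+1 would nest inside the arc at a or around the arc at z(a+2).  The base
-- point s₁s₃⋯ is non-nesting, so it suffices that bidirected edges preserve non-nesting.
--
-- If s ∈ τ(y), then D = (H_s − v) C_y is bar-invariant and has no terms of positive degree.
-- Triangularity of the bar involution makes the top-length part of a bar-invariant element
-- symmetric under v ↦ v⁻¹, so downward induction on length gives D = 0.  Comparing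
-- v⁻¹-coefficients at an ascent x of s then gives μ(x,y) = m(sxs,y)(v⁰), which vanishes unless
-- sxs = y; hence every bidirected edge joins some u to sus.  Finally, if conjugating a
-- non-nesting u by s creates a nesting, inspecting the arcs through a and a+1 shows that every
-- descent of u is one of sus, i.e. τ(u) ⊆ τ(sus), which an edge forbids.
module Submission where

open import Defs
open import Data.Nat using (ℕ; _≤_)
open import Data.Nat.Divisibility using (_∣_)
open import Data.Fin using (Fin)
open import Data.Product using (_×_)
open import Relation.Nullary using (¬_)

open import Data.Bool using (true; false; if_then_else_; _∧_)
open import Data.Bool.Properties using (∧-zeroʳ; if-cong)
open import Data.Empty using (⊥; ⊥-elim; ⊥-elim-irr)
open import Data.Fin using (toℕ; zero; suc; punchIn; fromℕ<)
open import Data.Fin.Properties using (_≟_; all?; any?; toℕ<n; toℕ-fromℕ<; toℕ-injective; punchInᵢ≢i)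
import Data.Fin.Permutation as Perm
import Data.Fin.Permutation.Components as PC
open import Data.List using (List; []; _∷_; allFin; applyUpTo; cartesianProductWith)
import Data.List as List
open import Data.List.Membership.Propositional using (_∈_; _∉_)
open import Data.List.Membership.Propositional.Properties using (∈-cartesianProductWith⁺; ∈-allFin; ∈-applyUpTo⁺)
open import Data.List.Properties using (map-tabulate)
open import Data.List.Relation.Unary.Any using (here; there)
open import Data.Product using (_,_; proj₁; proj₂; ∃-syntax)
open import Data.Sum using (_⊎_; inj₁; inj₂)
open import Data.Vec using (Vec; []; _∷_; lookup; tabulate)
open import Data.Vec.Properties using (lookup∘tabulate; tabulate∘lookup; tabulate-cong)
import Data.Vec.Properties as Vec
open import Function using (_∘_; id; flip)
open import Relation.Binary.PropositionalEquality
open import Relation.Binary.Definitions using (tri<; tri≈; tri>)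
open import Relation.Binary.Construct.Closure.ReflexiveTransitive using (Star; ε; _◅_)
open import Relation.Nullary using (Dec; yes; no; does; contradiction; ¬?)
open import Relation.Nullary.Decidable using (recompute; map′; dec-true; dec-false; _×-dec_; isYes≗does)

variable
  n : ℕ
  a b : Fin n

module Involutions where

  open import Data.Nat using (zero; suc; s≤s; z≤n; _+_; _⊔_; _*_; _<_; _≮_; _≰_; _<ᵇ_; z<s)
  import Data.Nat as ℕ
  open import Data.Nat.ListAction using () renaming (sum to sumᴸ)
  open import Data.Nat.Properties
    using (_<?_; _≤?_; ≰⇒>; <-≤-trans; ≤-<-trans; n≤1+n; ≤-antisym; <⇒≢; module ≤-Reasoning; m≤m⊔n; m≤n⊔m; <-cmp; ≤-refl; ≤-trans;
           <⇒≱; m<n+m; m≤n+m; <-irrefl; <-asym; <-trans; ≤-pred; ≤∧≢⇒<; n<1+n; 1+n≢n; suc-injective;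
           +-identityʳ; +-comm; *-identityʳ; +-*-semiring)
  open import Algebra.Properties.Semiring.Sum +-*-semiring
    using (sum; sum-syntax; sum-cong-≗; sum-remove; sum-replicate-zero; ∑-permute; ∑-distrib-+; *-distribˡ-sum)

  img : Fpf n → Fin n → ℕ
  img z i = toℕ (app z i)

  app-involutive : (z : Fpf n) (i : Fin n) → app z (app z i) ≡ i
  app-involutive (mkFpf p inv _) i = recompute (lookup p (lookup p i) ≟ i) (inv i)

  app-fpf : (z : Fpf n) (i : Fin n) → app z i ≢ i
  app-fpf (mkFpf _ _ fpf) i eq = ⊥-elim-irr (fpf i eq)

  app-sym : (z : Fpf n) {i j : Fin n} → app z i ≡ j → app z j ≡ i
  app-sym z {i} eq = trans (cong (app z) (sym eq)) (app-involutive z i)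

  app-injective : (z : Fpf n) {i j : Fin n} → app z i ≡ app z j → i ≡ j
  app-injective z {i} eq = trans (sym (app-sym z refl)) (app-sym z (sym eq))

  Fpf-≡ : {w z : Fpf n} → perm w ≡ perm z → w ≡ z
  Fpf-≡ {w = mkFpf _ _ _} {mkFpf _ _ _} refl = refl

  Fpf-ext : {w z : Fpf n} → (∀ i → app w i ≡ app z i) → w ≡ z
  Fpf-ext {w = w} {z} eq = Fpf-≡ (begin
    perm w                  ≡⟨ tabulate∘lookup (perm w) ⟨
    tabulate (lookup (perm w)) ≡⟨ tabulate-cong eq ⟩
    tabulate (lookup (perm z)) ≡⟨ tabulate∘lookup (perm z) ⟩
    perm z                  ∎)
    where open ≡-Reasoning

  _≟ᶠ_ : (w z : Fpf n) → Dec (w ≡ z)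
  w ≟ᶠ z = map′ Fpf-≡ (cong perm) (Vec.≡-dec _≟_ (perm w) (perm z))

  swap-first : (a b : Fin n) → swap a b a ≡ b
  swap-first a b with a ≟ a
  ... | yes _   = refl
  ... | no a≢a = contradiction refl a≢a

  swap-second : (a b : Fin n) → swap a b b ≡ a
  swap-second a b with b ≟ a
  ... | yes b≡a = b≡a
  ... | no _ with b ≟ b
  ...   | yes _   = refl
  ...   | no b≢b = contradiction refl b≢b

  swap-other : (a b : Fin n) {i : Fin n} → i ≢ a → i ≢ b → swap a b i ≡ i
  swap-other a b {i} i≢a i≢b with i ≟ a
  ... | yes i≡a = contradiction i≡a i≢a
  ... | no _ with i ≟ b
  ...   | yes i≡b = contradiction i≡b i≢b
  ...   | no _    = refl

  swap≗transpose : (a b : Fin n) (i : Fin n) → swap a b i ≡ PC.transpose a b i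
  swap≗transpose a b i with i ≟ a
  ... | yes _ = refl
  ... | no _ with i ≟ b
  ...   | yes _ = refl
  ...   | no _  = refl

  app-conj : (a b : Fin n) (z : Fpf n) (i : Fin n) → app (conj a b z) i ≡ swap a b (app z (swap a b i))
  app-conj a b z = lookup∘tabulate _

  conj-involutive : (a b : Fin n) (z : Fpf n) → conj a b (conj a b z) ≡ z
  conj-involutive a b z = Fpf-ext λ i → begin
    app (conj a b (conj a b z)) i                     ≡⟨ app-conj a b (conj a b z) i ⟩
    swap a b (app (conj a b z) (swap a b i))          ≡⟨ cong (swap a b) (app-conj a b z (swap a b i)) ⟩
    swap a b (swap a b (app z (swap a b (swap a b i)))) ≡⟨ swap-invol a b _ ⟩
    app z (swap a b (swap a b i))                     ≡⟨ cong (app z) (swap-invol a b i) ⟩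
    app z i                                           ∎
    where open ≡-Reasoning

  conj-injective : (a b : Fin n) {w z : Fpf n} → conj a b w ≡ conj a b z → w ≡ z
  conj-injective a b {w} {z} eq = trans (sym (conj-involutive a b w)) (trans (cong (conj a b) eq) (conj-involutive a b z))

  conj-fixed : (a b : Fin n) (z : Fpf n) → app z a ≡ b → conj a b z ≡ z
  conj-fixed a b z za≡b = Fpf-ext λ i → trans (app-conj a b z i) (fixes i (i ≟ a) (i ≟ b))
    where
    zb≡a : app z b ≡ a
    zb≡a = app-sym z za≡b
    fixes : ∀ i → Dec (i ≡ a) → Dec (i ≡ b) → swap a b (app z (swap a b i)) ≡ app z i
    fixes i (yes refl) _ = begin
      swap i b (app z (swap i b i)) ≡⟨ cong (swap i b ∘ app z) (swap-first i b) ⟩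
      swap i b (app z b)            ≡⟨ cong (swap i b) zb≡a ⟩
      swap i b i                    ≡⟨ swap-first i b ⟩
      b                             ≡⟨ za≡b ⟨
      app z i                       ∎
      where open ≡-Reasoning
    fixes i (no _) (yes refl) = begin
      swap a i (app z (swap a i i)) ≡⟨ cong (swap a i ∘ app z) (swap-second a i) ⟩
      swap a i (app z a)            ≡⟨ cong (swap a i) za≡b ⟩
      swap a i i                    ≡⟨ swap-second a i ⟩
      a                             ≡⟨ zb≡a ⟨
      app z i                       ∎
      where open ≡-Reasoning
    fixes i (no i≢a) (no i≢b) = begin
      swap a b (app z (swap a b i)) ≡⟨ cong (swap a b ∘ app z) (swap-other a b i≢a i≢b) ⟩
      swap a b (app z i)            ≡⟨ swap-other a b (λ e → i≢b (trans (sym (app-sym z e)) za≡b))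
                                                      (λ e → i≢a (trans (sym (app-sym z e)) zb≡a)) ⟩
      app z i                       ∎
      where open ≡-Reasoning

  adjSwap : ℕ → ℕ → ℕ
  adjSwap α x with x ℕ.≟ α
  ... | yes _ = suc α
  ... | no _ with x ℕ.≟ suc α
  ...   | yes _ = α
  ...   | no _  = x

  adjSwap-first : ∀ α → adjSwap α α ≡ suc α
  adjSwap-first α with α ℕ.≟ α
  ... | yes _   = refl
  ... | no α≢α = contradiction refl α≢α

  adjSwap-second : ∀ α → adjSwap α (suc α) ≡ α
  adjSwap-second α with suc α ℕ.≟ α
  ... | yes 1+α≡α = contradiction 1+α≡α (1+n≢n)
  ... | no _ with suc α ℕ.≟ suc α
  ...   | yes _       = refl
  ...   | no 1+α≢1+α = contradiction refl 1+α≢1+α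

  adjSwap-other : ∀ α {x} → x ≢ α → x ≢ suc α → adjSwap α x ≡ x
  adjSwap-other α {x} x≢α x≢1+α with x ℕ.≟ α
  ... | yes x≡α = contradiction x≡α x≢α
  ... | no _ with x ℕ.≟ suc α
  ...   | yes x≡1+α = contradiction x≡1+α x≢1+α
  ...   | no _      = refl

  adjSwap-involutive : ∀ α x → adjSwap α (adjSwap α x) ≡ x
  adjSwap-involutive α x with x ℕ.≟ α
  ... | yes refl = adjSwap-second α
  ... | no x≢α with x ℕ.≟ suc α
  ...   | yes refl  = adjSwap-first α
  ...   | no x≢1+α = adjSwap-other α x≢α x≢1+α

  adjSwap-< : ∀ α {x y} → x < y → ¬ (x ≡ α × y ≡ suc α) → adjSwap α x < adjSwap α y
  adjSwap-< α {x} {y} x<y ≢pair with x ℕ.≟ α | y ℕ.≟ α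
  ... | yes refl | yes refl = contradiction x<y (<-irrefl refl)
  ... | yes refl | no y≢α with y ℕ.≟ suc α
  ...   | yes y≡1+α = contradiction (refl , y≡1+α) ≢pair
  ...   | no y≢1+α  = ≤∧≢⇒< x<y (y≢1+α ∘ sym)
  adjSwap-< α {x} {y} x<y ≢pair | no x≢α | yes refl with x ℕ.≟ suc α
  ...   | yes refl = contradiction (n<1+n α) (<-asym x<y)
  ...   | no _     = <-trans x<y (n<1+n α)
  adjSwap-< α {x} {y} x<y ≢pair | no x≢α | no y≢α with x ℕ.≟ suc α | y ℕ.≟ suc α
  ... | yes refl | yes refl = contradiction x<y (<-irrefl refl)
  ... | yes refl | no _     = <-trans (n<1+n α) x<y
  ... | no _     | yes refl = ≤∧≢⇒< (≤-pred x<y) x≢α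
  ... | no _     | no _     = x<y

  adjSwap≡first : ∀ α {x} → adjSwap α x ≡ α → x ≡ suc α
  adjSwap≡first α {x} eq = trans (sym (adjSwap-involutive α x)) (trans (cong (adjSwap α) eq) (adjSwap-first α))

  adjSwap≡second : ∀ α {x} → adjSwap α x ≡ suc α → x ≡ α
  adjSwap≡second α {x} eq = trans (sym (adjSwap-involutive α x)) (trans (cong (adjSwap α) eq) (adjSwap-second α))

  <ᵇ-true : ∀ {x y} → x < y → (x <ᵇ y) ≡ true
  <ᵇ-true = dec-true (_ <? _)

  <ᵇ-false : ∀ {x y} → x ≮ y → (x <ᵇ y) ≡ false
  <ᵇ-false = dec-false (_ <? _)

  adjSwap-<ᵇ : ∀ α {x y} → ¬ (x ≡ α × y ≡ suc α) → ¬ (x ≡ suc α × y ≡ α) →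
               (adjSwap α x <ᵇ adjSwap α y) ≡ (x <ᵇ y)
  adjSwap-<ᵇ α {x} {y} ≢pair ≢pair′ with x <? y
  ... | yes x<y = trans (<ᵇ-true (adjSwap-< α x<y ≢pair)) (sym (<ᵇ-true x<y))
  ... | no x≮y  = trans (<ᵇ-false sx≮sy) (sym (<ᵇ-false x≮y))
    where
    sx≮sy : adjSwap α x ≮ adjSwap α y
    sx≮sy sx<sy = x≮y (subst₂ _<_ (adjSwap-involutive α x) (adjSwap-involutive α y)
      (adjSwap-< α sx<sy λ (sx≡α , sy≡1+α) → ≢pair′ (adjSwap≡first α sx≡α , adjSwap≡second α sy≡1+α)))

  IsSimple⇒≢ : IsSimple a b → a ≢ b
  IsSimple⇒≢ s refl = 1+n≢n (sym s)

  toℕ-swap : IsSimple a b → (i : Fin n) → toℕ (swap a b i) ≡ adjSwap (toℕ a) (toℕ i)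
  toℕ-swap {a = a} {b} s i = byCases (i ≟ a) (i ≟ b)
    where
    open ≡-Reasoning
    byCases : Dec (i ≡ a) → Dec (i ≡ b) → toℕ (swap a b i) ≡ adjSwap (toℕ a) (toℕ i)
    byCases (yes refl) _ = trans (cong toℕ (swap-first a b)) (trans s (sym (adjSwap-first (toℕ a))))
    byCases (no _) (yes refl) = begin
      toℕ (swap a b b)              ≡⟨ cong toℕ (swap-second a b) ⟩
      toℕ a                         ≡⟨ adjSwap-second (toℕ a) ⟨
      adjSwap (toℕ a) (suc (toℕ a)) ≡⟨ cong (adjSwap (toℕ a)) s ⟨
      adjSwap (toℕ a) (toℕ b)       ∎
    byCases (no i≢a) (no i≢b) = trans (cong toℕ (swap-other a b i≢a i≢b))
      (sym (adjSwap-other (toℕ a) (i≢a ∘ toℕ-injective) (λ e → i≢b (toℕ-injective (trans e (sym s))))))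

  img-conj : IsSimple a b → (z : Fpf n) (i : Fin n) → img (conj a b z) (swap a b i) ≡ adjSwap (toℕ a) (img z i)
  img-conj {a = a} {b} s z i = begin
    toℕ (app (conj a b z) (swap a b i))             ≡⟨ cong toℕ (app-conj a b z (swap a b i)) ⟩
    toℕ (swap a b (app z (swap a b (swap a b i)))) ≡⟨ cong (λ j → toℕ (swap a b (app z j))) (swap-invol a b i) ⟩
    toℕ (swap a b (app z i))                      ≡⟨ toℕ-swap s (app z i) ⟩
    adjSwap (toℕ a) (img z i)                     ∎
    where open ≡-Reasoning

  module _ {a b : Fin n} (s : IsSimple a b) (z : Fpf n) (za≢b : app z a ≢ b) where

    img-conj-first : img (conj a b z) a ≡ img z b
    img-conj-first = begin
      img (conj a b z) a              ≡⟨ cong (img (conj a b z)) (swap-second a b) ⟨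
      img (conj a b z) (swap a b b)   ≡⟨ img-conj s z b ⟩
      adjSwap (toℕ a) (img z b)       ≡⟨ adjSwap-other (toℕ a) (λ e → za≢b (app-sym z (toℕ-injective e)))
                                                              (λ e → app-fpf z b (toℕ-injective (trans e (sym s)))) ⟩
      img z b                         ∎
      where open ≡-Reasoning

    img-conj-second : img (conj a b z) b ≡ img z a
    img-conj-second = begin
      img (conj a b z) b              ≡⟨ cong (img (conj a b z)) (swap-first a b) ⟨
      img (conj a b z) (swap a b a)   ≡⟨ img-conj s z a ⟩
      adjSwap (toℕ a) (img z a)       ≡⟨ adjSwap-other (toℕ a) (app-fpf z a ∘ toℕ-injective)
                                                              (λ e → za≢b (toℕ-injective (trans e (sym s)))) ⟩
      img z a                         ∎
      where open ≡-Reasoning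

    conj-notFixed : app (conj a b z) a ≢ b
    conj-notFixed e = app-fpf z b (toℕ-injective (trans (sym img-conj-first) (cong toℕ e)))

  -- The length of a simple conjugate

  sumᴸ-allFin : (f : Fin n → ℕ) → sumᴸ (List.map f (allFin n)) ≡ ∑[ i < n ] f i
  sumᴸ-allFin f = trans (cong sumᴸ (map-tabulate id f)) (sumᴸ-tabulate f)
    where
    sumᴸ-tabulate : ∀ {n} (f : Fin n → ℕ) → sumᴸ (List.tabulate f) ≡ ∑[ i < n ] f i
    sumᴸ-tabulate {zero}  f = refl
    sumᴸ-tabulate {suc n} f = cong (f zero +_) (sumᴸ-tabulate (f ∘ suc))

  ∑-swap : (a b : Fin n) (f : Fin n → ℕ) → ∑[ i < n ] f (swap a b i) ≡ ∑[ i < n ] f i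
  ∑-swap a b f = trans (sum-cong-≗ (cong f ∘ swap≗transpose a b)) (sym (∑-permute f (Perm.transpose a b)))

  ∑∑-swap : (a b : Fin n) (f : Fin n → Fin n → ℕ) →
            ∑[ i < n ] ∑[ j < n ] f (swap a b i) (swap a b j) ≡ ∑[ i < n ] ∑[ j < n ] f i j
  ∑∑-swap a b f = trans (sum-cong-≗ (λ i → ∑-swap a b (f (swap a b i)))) (∑-swap a b (λ i → ∑[ j < _ ] f i j))

  ∑∑-distrib-+ : (f g : Fin n → Fin n → ℕ) →
                 ∑[ i < n ] ∑[ j < n ] (f i j + g i j) ≡ ∑[ i < n ] ∑[ j < n ] f i j + ∑[ i < n ] ∑[ j < n ] g i j
  ∑∑-distrib-+ f g = trans (sum-cong-≗ (λ i → ∑-distrib-+ (f i) (g i))) (∑-distrib-+ (λ i → sum (f i)) (λ i → sum (g i)))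

  indicator : Fin n → Fin n → ℕ
  indicator c i = if does (i ≟ c) then 1 else 0

  indicator-self : (c : Fin n) → indicator c c ≡ 1
  indicator-self c = cong (λ t → if t then 1 else 0) (dec-true (c ≟ c) refl)

  indicator-other : {c i : Fin n} → i ≢ c → indicator c i ≡ 0
  indicator-other {c = c} {i} i≢c = cong (λ t → if t then 1 else 0) (dec-false (i ≟ c) i≢c)

  ∑-indicator : (c : Fin n) → ∑[ i < n ] indicator c i ≡ 1
  ∑-indicator {suc n} c = begin
    sum (indicator c)                             ≡⟨ sum-remove {i = c} (indicator c) ⟩
    indicator c c + sum (indicator c ∘ punchIn c) ≡⟨ cong₂ _+_ (indicator-self c) (sum-cong-≗ (indicator-other ∘ punchInᵢ≢i c)) ⟩
    1 + sum {n} (λ _ → 0)                         ≡⟨ cong (1 +_) (sum-replicate-zero n) ⟩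
    1                                             ∎
    where open ≡-Reasoning

  pairIndicator : Fin n → Fin n → Fin n → Fin n → ℕ
  pairIndicator c d i j = indicator c i * indicator d j

  pairIndicator-self : (c d : Fin n) → pairIndicator c d c d ≡ 1
  pairIndicator-self c d = cong₂ _*_ (indicator-self c) (indicator-self d)

  pairIndicator-other : (c d i j : Fin n) → ¬ (i ≡ c × j ≡ d) → pairIndicator c d i j ≡ 0
  pairIndicator-other c d i j ≢cd with i ≟ c
  ... | no _     = refl
  ... | yes refl = cong (1 *_) (indicator-other (λ j≡d → ≢cd (refl , j≡d)))

  ∑∑-pairIndicator : (c d : Fin n) → ∑[ i < n ] ∑[ j < n ] pairIndicator c d i j ≡ 1
  ∑∑-pairIndicator c d = begin
    ∑[ i < _ ] ∑[ j < _ ] (indicator c i * indicator d j) ≡⟨ sum-cong-≗ (λ i → *-distribˡ-sum (indicator c i) (indicator d)) ⟨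
    ∑[ i < _ ] (indicator c i * ∑[ j < _ ] indicator d j) ≡⟨ sum-cong-≗ (λ i → trans (cong (indicator c i *_) (∑-indicator d)) (*-identityʳ _)) ⟩
    ∑[ i < _ ] indicator c i                            ≡⟨ ∑-indicator c ⟩
    1                                                   ∎
    where open ≡-Reasoning

  crossing : ℕ → ℕ → ℕ → ℕ → ℕ
  crossing x y u v = if (x <ᵇ y) ∧ (v <ᵇ u) then 1 else 0

  crossing-true : ∀ {x y u v} → x < y → v < u → crossing x y u v ≡ 1
  crossing-true x<y v<u = cong₂ (λ p q → if p ∧ q then 1 else 0) (<ᵇ-true x<y) (<ᵇ-true v<u)

  crossing-false₁ : ∀ {x y} u v → x ≮ y → crossing x y u v ≡ 0
  crossing-false₁ u v x≮y = cong (λ p → if p ∧ (v <ᵇ u) then 1 else 0) (<ᵇ-false x≮y)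

  crossing-false₂ : ∀ x y {u v} → v ≮ u → crossing x y u v ≡ 0
  crossing-false₂ x y v≮u = trans (cong (λ q → if (x <ᵇ y) ∧ q then 1 else 0) (<ᵇ-false v≮u))
                                      (cong (λ p → if p then 1 else 0) (∧-zeroʳ (x <ᵇ y)))

  inversion : Fpf n → Fin n → Fin n → ℕ
  inversion z i j = crossing (toℕ i) (toℕ j) (img z i) (img z j)

  len≡∑∑inversion : (z : Fpf n) → len z ≡ ∑[ i < n ] ∑[ j < n ] inversion z i j
  len≡∑∑inversion {n} z = trans (sumᴸ-allFin (λ i → sumᴸ (List.map (inversion z i) (allFin n)))) (sum-cong-≗ λ i → sumᴸ-allFin (inversion z i))

  img≡⇒≡app : (z : Fpf n) {i c : Fin n} → img z i ≡ toℕ c → i ≡ app z c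
  img≡⇒≡app z eq = sym (app-sym z (toℕ-injective eq))

  module _ {a b : Fin n} (s : IsSimple a b) (z : Fpf n) (za≢b : app z a ≢ b) (ascent : img z a < img z b) where
    private
      α : ℕ
      α = toℕ a
      σ : ℕ → ℕ
      σ = adjSwap α
      za zb : Fin n
      za = app z a
      zb = app z b

      σa : σ (toℕ a) ≡ suc α
      σa = adjSwap-first α
      σb : σ (toℕ b) ≡ α
      σb = trans (cong σ s) (adjSwap-second α)
      σza : σ (img z a) ≡ img z a
      σza = adjSwap-other α (app-fpf z a ∘ toℕ-injective) (λ e → za≢b (toℕ-injective (trans e (sym s))))
      σzb : σ (img z b) ≡ img z b
      σzb = adjSwap-other α (λ e → za≢b (app-sym z (toℕ-injective e))) (λ e → app-fpf z b (toℕ-injective (trans e (sym s))))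
      σzza : σ (img z za) ≡ suc α
      σzza = trans (cong (σ ∘ toℕ) (app-involutive z a)) σa
      σzzb : σ (img z zb) ≡ α
      σzzb = trans (cong (σ ∘ toℕ) (app-involutive z b)) σb

      -- After reindexing by s, the inversions of the conjugate are those of z plus (b , a) and (z a , z b).
      lhs rhs : Fin n → Fin n → ℕ
      lhs i j = crossing (σ (toℕ i)) (σ (toℕ j)) (σ (img z i)) (σ (img z j))
      rhs i j = inversion z i j + pairIndicator b a i j + pairIndicator za zb i j

      rhs-≡ : ∀ i j {x y w} → inversion z i j ≡ x → pairIndicator b a i j ≡ y → pairIndicator za zb i j ≡ w →
              rhs i j ≡ x + y + w
      rhs-≡ _ _ p q r = cong₂ _+_ (cong₂ _+_ p q) r

      at-ab : lhs a b ≡ rhs a b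
      at-ab = trans (crossing-false₁ (σ (img z a)) (σ (img z b)) (subst₂ _≮_ (sym σa) (sym σb) (<-asym (n<1+n α))))
                    (sym (rhs-≡ a b (crossing-false₂ (toℕ a) (toℕ b) (<-asym ascent))
                                    (pairIndicator-other b a a b (IsSimple⇒≢ s ∘ proj₁))
                                    (pairIndicator-other za zb a b (app-fpf z a ∘ sym ∘ proj₁))))

      at-ba : lhs b a ≡ rhs b a
      at-ba = trans (crossing-true (subst₂ _<_ (sym σb) (sym σa) (n<1+n α)) (subst₂ _<_ (sym σza) (sym σzb) ascent))
                    (sym (rhs-≡ b a (crossing-false₁ (img z b) (img z a) (subst (_≮ α) (sym s) (<-asym (n<1+n α))))
                                    (pairIndicator-self b a)
                                    (pairIndicator-other za zb b a (za≢b ∘ sym ∘ proj₁))))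

      at-zazb : lhs za zb ≡ rhs za zb
      at-zazb = trans (crossing-true (adjSwap-< α ascent (app-fpf z a ∘ toℕ-injective ∘ proj₁))
                                     (subst₂ _<_ (sym σzzb) (sym σzza) (n<1+n α)))
                      (sym (rhs-≡ za zb (crossing-false₂ (img z a) (img z b)
                                           (subst₂ _≮_ (sym (trans (cong toℕ (app-involutive z b)) s))
                                                       (sym (cong toℕ (app-involutive z a))) (<-asym (n<1+n α))))
                                        (pairIndicator-other b a za zb (za≢b ∘ proj₁))
                                        (pairIndicator-self za zb)))

      at-zbza : lhs zb za ≡ rhs zb za
      at-zbza = trans (crossing-false₁ (σ (img z zb)) (σ (img z za)) (λ σzb<σza → <-asym ascent (subst₂ _<_ σzb σza σzb<σza)))
                      (sym (rhs-≡ zb za (crossing-false₁ (img z zb) (img z za) (<-asym ascent))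
                                        (pairIndicator-other b a zb za (app-fpf z b ∘ proj₁))
                                        (pairIndicator-other za zb zb za
                                           (λ (zb≡za , _) → IsSimple⇒≢ s (app-injective z (sym zb≡za))))))

      elsewhere : ∀ {i j} → ¬ (i ≡ a × j ≡ b) → ¬ (i ≡ b × j ≡ a) → ¬ (i ≡ za × j ≡ zb) → ¬ (i ≡ zb × j ≡ za) →
                  lhs i j ≡ rhs i j
      elsewhere {i} {j} ≢ab ≢ba ≢zazb ≢zbza = begin
        lhs i j                  ≡⟨ cong₂ (λ p q → if p ∧ q then 1 else 0) positions values ⟩
        inversion z i j          ≡⟨ +-identityʳ _ ⟨
        inversion z i j + 0      ≡⟨ +-identityʳ _ ⟨
        inversion z i j + 0 + 0  ≡⟨ rhs-≡ i j refl (pairIndicator-other b a i j ≢ba) (pairIndicator-other za zb i j ≢zazb) ⟨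
        rhs i j                  ∎
        where
        open ≡-Reasoning
        positions : (σ (toℕ i) <ᵇ σ (toℕ j)) ≡ (toℕ i <ᵇ toℕ j)
        positions = adjSwap-<ᵇ α (λ (i≡a , j≡b) → ≢ab (toℕ-injective i≡a , toℕ-injective (trans j≡b (sym s))))
                                 (λ (i≡b , j≡a) → ≢ba (toℕ-injective (trans i≡b (sym s)) , toℕ-injective j≡a))
        values : (σ (img z j) <ᵇ σ (img z i)) ≡ (img z j <ᵇ img z i)
        values = adjSwap-<ᵇ α (λ (zj≡α , zi≡1+α) → ≢zbza (img≡⇒≡app z (trans zi≡1+α (sym s)) , img≡⇒≡app z zj≡α))
                              (λ (zj≡1+α , zi≡α) → ≢zazb (img≡⇒≡app z zi≡α , img≡⇒≡app z (trans zj≡1+α (sym s))))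

      lhs≡rhs : ∀ i j → lhs i j ≡ rhs i j
      lhs≡rhs i j with (i ≟ a) ×-dec (j ≟ b) | (i ≟ b) ×-dec (j ≟ a) | (i ≟ za) ×-dec (j ≟ zb) | (i ≟ zb) ×-dec (j ≟ za)
      ... | yes (refl , refl) | _                   | _                   | _                   = at-ab
      ... | no _              | yes (refl , refl)   | _                   | _                   = at-ba
      ... | no _              | no _                | yes (refl , refl)   | _                   = at-zazb
      ... | no _              | no _                | no _                | yes (refl , refl)   = at-zbza
      ... | no ≢ab            | no ≢ba              | no ≢zazb            | no ≢zbza            = elsewhere ≢ab ≢ba ≢zazb ≢zbza

      inversion-conj : ∀ i j → inversion (conj a b z) (swap a b i) (swap a b j) ≡ lhs i j
      inversion-conj i j rewrite toℕ-swap s i | toℕ-swap s j | img-conj s z i | img-conj s z j = refl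

    len-conj-ascent : len (conj a b z) ≡ 2 + len z
    len-conj-ascent = begin
      len (conj a b z)
        ≡⟨ len≡∑∑inversion (conj a b z) ⟩
      ∑[ i < n ] ∑[ j < n ] inversion (conj a b z) i j
        ≡⟨ ∑∑-swap a b (inversion (conj a b z)) ⟨
      ∑[ i < n ] ∑[ j < n ] inversion (conj a b z) (swap a b i) (swap a b j)
        ≡⟨ sum-cong-≗ (λ i → sum-cong-≗ (λ j → trans (inversion-conj i j) (lhs≡rhs i j))) ⟩
      ∑[ i < n ] ∑[ j < n ] rhs i j
        ≡⟨ ∑∑-distrib-+ (λ i j → inversion z i j + pairIndicator b a i j) (pairIndicator za zb) ⟩
      ∑[ i < n ] ∑[ j < n ] (inversion z i j + pairIndicator b a i j) + ∑[ i < n ] ∑[ j < n ] pairIndicator za zb i j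
        ≡⟨ cong₂ _+_ (∑∑-distrib-+ (inversion z) (pairIndicator b a)) (∑∑-pairIndicator za zb) ⟩
      ∑[ i < n ] ∑[ j < n ] inversion z i j + ∑[ i < n ] ∑[ j < n ] pairIndicator b a i j + 1
        ≡⟨ cong (λ m → m + _ + 1) (len≡∑∑inversion z) ⟨
      len z + ∑[ i < n ] ∑[ j < n ] pairIndicator b a i j + 1
        ≡⟨ cong (λ m → len z + m + 1) (∑∑-pairIndicator b a) ⟩
      len z + 1 + 1
        ≡⟨ +-comm (len z + 1) 1 ⟩
      1 + (len z + 1)
        ≡⟨ cong suc (+-comm (len z) 1) ⟩
      2 + len z
        ∎
      where open ≡-Reasoning

  -- Descents and τ

  Descent : Fpf n → Fin n → Fin n → Set
  Descent z a b = img z b < img z a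

  data Position (a b : Fin n) (z : Fpf n) : Set where
    fixed   : app z a ≡ b → Position a b z
    ascent  : app z a ≢ b → img z a < img z b → Position a b z
    descent : app z a ≢ b → Descent z a b → Position a b z

  position : IsSimple a b → (z : Fpf n) → Position a b z
  position {a = a} {b} s z with app z a ≟ b
  ... | yes za≡b = fixed za≡b
  ... | no za≢b with <-cmp (img z a) (img z b)
  ...   | tri< za<zb _ _ = ascent za≢b za<zb
  ...   | tri≈ _ za≡zb _ = contradiction (app-injective z (toℕ-injective za≡zb)) (IsSimple⇒≢ s)
  ...   | tri> _ _ zb<za = descent za≢b zb<za

  fixed⇒Descent : IsSimple a b → (z : Fpf n) → app z a ≡ b → Descent z a b
  fixed⇒Descent {a = a} s z za≡b =
    subst₂ _<_ (cong toℕ (sym (app-sym z za≡b))) (trans (sym s) (cong toℕ (sym za≡b))) (n<1+n (toℕ a))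

  ascent-conj : IsSimple a b → (z : Fpf n) → app z a ≢ b → Descent z a b → img (conj a b z) a < img (conj a b z) b
  ascent-conj s z za≢b = subst₂ _<_ (sym (img-conj-first s z za≢b)) (sym (img-conj-second s z za≢b))

  len-conj-descent : IsSimple a b → (z : Fpf n) → app z a ≢ b → Descent z a b → len z ≡ 2 + len (conj a b z)
  len-conj-descent {a = a} {b} s z za≢b d = begin
    len z                        ≡⟨ cong len (conj-involutive a b z) ⟨
    len (conj a b (conj a b z))  ≡⟨ len-conj-ascent s (conj a b z) (conj-notFixed s z za≢b) (ascent-conj s z za≢b d) ⟩
    2 + len (conj a b z)         ∎
    where open ≡-Reasoning

  ≤B⇒len≤ : {w z : Fpf n} → w ≤B z → len w ≤ len z
  ≤B⇒len≤ ε                                  = ≤-refl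
  ≤B⇒len≤ ((_ , _ , _ , _ , len≤) ◅ steps) = ≤-trans len≤ (≤B⇒len≤ steps)

  InTau⇒Descent : IsSimple a b → (z : Fpf n) → InTau z a b → Descent z a b
  InTau⇒Descent s z sz≤z with position s z
  ... | fixed za≡b         = fixed⇒Descent s z za≡b
  ... | ascent za≢b za<zb = contradiction (≤B⇒len≤ sz≤z) (subst (_≰ len z) (sym (len-conj-ascent s z za≢b za<zb)) (<⇒≱ (m<n+m _ {2} z<s)))
  ... | descent _ d        = d

  Descent⇒InTau : IsSimple a b → (z : Fpf n) → Descent z a b → InTau z a b
  Descent⇒InTau {a = a} {b} s z d with position s z
  ... | fixed za≡b        = subst (_≤B z) (sym (conj-fixed a b z za≡b)) ε
  ... | ascent _ za<zb   = contradiction d (<-asym za<zb)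
  ... | descent za≢b _    = (a , b , IsSimple⇒≢ s , sym (conj-involutive a b z) , len≤) ◅ ε
    where
    len≤ : len (conj a b z) ≤ len z
    len≤ = subst (len (conj a b z) ≤_) (sym (len-conj-descent s z za≢b d)) (m≤n+m _ 2)

  ¬TauSub⇒witness : (x y : Fpf n) → ¬ TauSub x y → ∃[ a ] ∃[ b ] IsSimple {n} a b × Descent x a b × ¬ Descent y a b
  ¬TauSub⇒witness x y x⊈y with any? (λ a → any? λ b →
                                  (toℕ b ℕ.≟ suc (toℕ a)) ×-dec (img x b <? img x a) ×-dec ¬? (img y b <? img y a))
  ... | yes witness = witness
  ... | no none     = contradiction x⊆y x⊈y
    where
    x⊆y : TauSub x y
    x⊆y a b s sxs≤x with img y b <? img y a
    ... | yes d  = Descent⇒InTau s y d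
    ... | no ¬d = contradiction (a , b , s , InTau⇒Descent s x sxs≤x , ¬d) none

  allVec : (m : ℕ) → List (Vec (Fin n) m)
  allVec zero    = [] ∷ []
  allVec (suc m) = cartesianProductWith _∷_ (allFin _) (allVec m)

  ∈-allVec : {m : ℕ} (v : Vec (Fin n) m) → v ∈ allVec m
  ∈-allVec []       = here refl
  ∈-allVec (i ∷ v) = ∈-cartesianProductWith⁺ _∷_ (∈-allFin i) (∈-allVec v)

  fpfsOf : List (Vec (Fin n) n) → List (Fpf n)
  fpfsOf []       = []
  fpfsOf (p ∷ ps) with all? (λ i → lookup p (lookup p i) ≟ i) | all? (λ i → ¬? (lookup p i ≟ i))
  ... | yes inv | yes fpf = mkFpf p inv fpf ∷ fpfsOf ps
  ... | _       | _       = fpfsOf ps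

  ∈-fpfsOf : (z : Fpf n) (ps : List (Vec (Fin n) n)) → perm z ∈ ps → z ∈ fpfsOf ps
  ∈-fpfsOf z (p ∷ ps) z∈ with all? (λ i → lookup p (lookup p i) ≟ i) | all? (λ i → ¬? (lookup p i ≟ i)) | z∈
  ... | yes _   | yes _   | here refl = here refl
  ... | yes _   | yes _   | there z∈′ = there (∈-fpfsOf z ps z∈′)
  ... | no ¬inv | _       | here refl = contradiction (app-involutive z) ¬inv
  ... | yes _   | no ¬fpf | here refl = contradiction (app-fpf z) ¬fpf
  ... | no _    | _       | there z∈′ = ∈-fpfsOf z ps z∈′
  ... | yes _   | no _    | there z∈′ = ∈-fpfsOf z ps z∈′

  allFpf : (n : ℕ) → List (Fpf n)
  allFpf n = fpfsOf (allVec n)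

  ∈-allFpf : (z : Fpf n) → z ∈ allFpf n
  ∈-allFpf z = ∈-fpfsOf z _ (∈-allVec (perm z))

  maxLen : List (Fpf n) → ℕ
  maxLen = List.foldr (λ z m → len z ⊔ m) 0

  len≤maxLen : {zs : List (Fpf n)} {z : Fpf n} → z ∈ zs → len z ≤ maxLen zs
  len≤maxLen (here refl) = m≤m⊔n _ _
  len≤maxLen (there z∈)  = ≤-trans (len≤maxLen z∈) (m≤n⊔m _ _)

  -- Elements without proper descents

  twice : ℕ → ℕ
  twice zero    = zero
  twice (suc m) = suc (suc (twice m))

  partner-twice : ∀ m → partner (twice m) ≡ suc (twice m)
  partner-twice zero    = refl
  partner-twice (suc m) = cong (2 +_) (partner-twice m)

  partner-suc-twice : ∀ m → partner (suc (twice m)) ≡ twice m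
  partner-suc-twice zero    = refl
  partner-suc-twice (suc m) = cong (2 +_) (partner-suc-twice m)

  parity : ∀ k → (∃[ m ] k ≡ twice m) ⊎ (∃[ m ] k ≡ suc (twice m))
  parity zero = inj₁ (0 , refl)
  parity (suc k) with parity k
  ... | inj₁ (m , k≡2m)   = inj₂ (m , cong suc k≡2m)
  ... | inj₂ (m , k≡2m+1) = inj₁ (suc m , cong suc k≡2m+1)

  ProperDescent : Fpf n → Set
  ProperDescent {n} u = ∃[ a ] ∃[ b ] IsSimple {n} a b × Descent u a b × app u a ≢ b

  properDescent? : (u : Fpf n) → Dec (ProperDescent u)
  properDescent? u = any? λ a → any? λ b →
    (toℕ b ℕ.≟ suc (toℕ a)) ×-dec (img u b <? img u a) ×-dec ¬? (app u a ≟ b)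

  m<n⇒n≡1+o : ∀ {m k} → suc m ≤ k → ∃[ q ] k ≡ suc q × m ≤ q
  m<n⇒n≡1+o (s≤s m≤q) = _ , refl , m≤q

  module _ (u : Fpf n) (noProper : ¬ ProperDescent u) where

    descent⇒fixed : IsSimple a b → Descent u a b → app u a ≡ b
    descent⇒fixed {a = a} {b} s d with app u a ≟ b
    ... | yes ua≡b = ua≡b
    ... | no ua≢b  = contradiction (a , b , s , d , ua≢b) noProper

    -- A longer arc i ↦ p makes (p-1 , p) a proper descent or violates the bound at a smaller point.
    img≤suc : ∀ i → img u i ≤ suc (toℕ i)
    img≤suc i = bounded (suc (toℕ i)) i ≤-refl
      where
      bounded : ∀ bound (i : Fin n) → toℕ i < bound → img u i ≤ suc (toℕ i)
      bounded (suc bound) i (s≤s i≤bound) with img u i ≤? suc (toℕ i)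
      ... | yes short = short
      ... | no long with m<n⇒n≡1+o (≰⇒> long)
      ...   | q , ui≡1+q , 1+i≤q = ⊥-elim noLongArc
        where
        q<n : q < n
        q<n = <-trans (n<1+n q) (subst (_< n) ui≡1+q (toℕ<n (app u i)))
        Q : Fin n
        Q = fromℕ< q<n
        toℕ-Q : toℕ Q ≡ q
        toℕ-Q = toℕ-fromℕ< q<n
        Q-simple : IsSimple Q (app u i)
        Q-simple = trans ui≡1+q (cong suc (sym toℕ-Q))
        noLongArc : ⊥
        noLongArc with <-cmp (img u Q) (toℕ i)
        ... | tri< uQ<i _ _ = <⇒≱ 1+i≤q (begin
          q                       ≡⟨ trans (sym toℕ-Q) (cong toℕ (sym (app-involutive u Q))) ⟩
          img u (app u Q)         ≤⟨ bounded bound (app u Q) (<-≤-trans uQ<i i≤bound) ⟩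
          suc (img u Q)           ≤⟨ uQ<i ⟩
          toℕ i                   ∎)
          where open ≤-Reasoning
        ... | tri≈ _ uQ≡i _ = 1+n≢n (begin
          suc q                   ≡⟨ ui≡1+q ⟨
          img u i                 ≡⟨ cong toℕ (app-sym u (toℕ-injective uQ≡i)) ⟩
          toℕ Q                   ≡⟨ toℕ-Q ⟩
          q                       ∎)
          where open ≡-Reasoning
        ... | tri> _ _ i<uQ = <-irrefl (trans (cong toℕ (sym Q≡i)) toℕ-Q) 1+i≤q
          where
          Q-descent : Descent u Q (app u i)
          Q-descent = subst (_< img u Q) (cong toℕ (sym (app-involutive u i))) i<uQ
          Q≡i : Q ≡ i
          Q≡i = app-injective u (descent⇒fixed Q-simple Q-descent)

    img-adjacent : ∀ i → img u i ≡ suc (toℕ i) ⊎ suc (img u i) ≡ toℕ i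
    img-adjacent i with <-cmp (img u i) (toℕ i)
    ... | tri< ui<i _ _ = inj₂ (≤-antisym ui<i (subst (_≤ suc (img u i)) (cong toℕ (app-involutive u i)) (img≤suc (app u i))))
    ... | tri≈ _ ui≡i _ = contradiction (toℕ-injective ui≡i) (app-fpf u i)
    ... | tri> _ _ i<ui = inj₁ (≤-antisym (img≤suc i) i<ui)

    img-twice : ∀ m (i : Fin n) → toℕ i ≡ twice m → img u i ≡ suc (twice m)
    img-twice m i i≡2m with img-adjacent i
    ... | inj₁ ui≡1+i = trans ui≡1+i (cong suc i≡2m)
    img-twice zero    i i≡0    | inj₂ 1+ui≡i = contradiction (trans 1+ui≡i i≡0) λ ()
    img-twice (suc m) i i≡2m+2 | inj₂ 1+ui≡i = contradiction (trans (sym toℕ-j) (cong toℕ j≡i)) (<⇒≢ 2m<i ∘ flip trans i≡2m+2)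
      where
      2m<i : twice m < suc (suc (twice m))
      2m<i = <-trans (n<1+n _) (n<1+n _)
      2m<n : twice m < n
      2m<n = <-trans 2m<i (subst (_< n) i≡2m+2 (toℕ<n i))
      j : Fin n
      j = fromℕ< 2m<n
      toℕ-j : toℕ j ≡ twice m
      toℕ-j = toℕ-fromℕ< 2m<n
      j≡i : j ≡ i
      j≡i = app-injective u (toℕ-injective (trans (img-twice m j toℕ-j) (suc-injective (sym (trans 1+ui≡i i≡2m+2)))))

    img-partner : ∀ i → img u i ≡ partner (toℕ i)
    img-partner i with parity (toℕ i)
    ... | inj₁ (m , i≡2m)   = trans (img-twice m i i≡2m) (trans (sym (partner-twice m)) (cong partner (sym i≡2m)))
    ... | inj₂ (m , i≡2m+1) = begin
      img u i                 ≡⟨ cong toℕ (app-sym u uj≡i) ⟩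
      toℕ j                   ≡⟨ toℕ-j ⟩
      twice m                 ≡⟨ partner-suc-twice m ⟨
      partner (suc (twice m)) ≡⟨ cong partner i≡2m+1 ⟨
      partner (toℕ i)         ∎
      where
      open ≡-Reasoning
      2m<n : twice m < n
      2m<n = <-trans (subst (twice m <_) (sym i≡2m+1) (n<1+n _)) (toℕ<n i)
      j : Fin n
      j = fromℕ< 2m<n
      toℕ-j : toℕ j ≡ twice m
      toℕ-j = toℕ-fromℕ< 2m<n
      uj≡i : app u j ≡ i
      uj≡i = toℕ-injective (trans (img-twice m j toℕ-j) (sym i≡2m+1))

  noProperDescent⇒base : {u z0 : Fpf n} → ¬ ProperDescent u → IsBase z0 → u ≡ z0
  noProperDescent⇒base {u = u} noProper z0-base = Fpf-ext λ i → toℕ-injective (trans (img-partner u noProper i) (sym (z0-base i)))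

  -- Non-nesting involutions

  NonNesting : Fpf n → Set
  NonNesting {n} u = ∀ (i j : Fin n) → toℕ i < toℕ j → toℕ j < img u j → img u j < img u i → ⊥

  DescentSubset : Fpf n → Fpf n → Set
  DescentSubset {n} x y = ∀ (c d : Fin n) → IsSimple c d → Descent x c d → Descent y c d

  DescentSubset⇒TauSub : {x y : Fpf n} → DescentSubset x y → TauSub x y
  DescentSubset⇒TauSub {x = x} {y} x⊆y c d s = Descent⇒InTau s y ∘ x⊆y c d s ∘ InTau⇒Descent s x

  partner≤suc : ∀ k → partner k ≤ suc k
  partner≤suc zero          = s≤s z≤n
  partner≤suc (suc zero)    = z≤n
  partner≤suc (suc (suc k)) = s≤s (s≤s (partner≤suc k))

  base-nonNesting : (z0 : Fpf n) → IsBase z0 → NonNesting z0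
  base-nonNesting z0 z0-base i j i<j j<z0j z0j<z0i = <-irrefl refl (begin-strict
    toℕ j              <⟨ j<z0j ⟩
    img z0 j           <⟨ z0j<z0i ⟩
    img z0 i           ≡⟨ z0-base i ⟩
    partner (toℕ i)    ≤⟨ partner≤suc (toℕ i) ⟩
    suc (toℕ i)        ≤⟨ i<j ⟩
    toℕ j              ∎)
    where open ≤-Reasoning

  nonNesting⇒¬consecutiveDescents : (x : Fpf n) {c : Fin n} → NonNesting x →
                                    IsSimple a b → IsSimple b c → Descent x a b → Descent x b c → ⊥
  nonNesting⇒¬consecutiveDescents {a = a} {b} x {c} nonNesting ab bc xb<xa xc<xb with <-cmp (img x b) (toℕ b)
  ... | tri> _ _ b<xb = nonNesting a b (subst (toℕ a <_) (sym ab) (n<1+n _)) b<xb xb<xa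
  ... | tri≈ _ xb≡b _ = app-fpf x b (toℕ-injective xb≡b)
  ... | tri< xb<b _ _ = nonNesting (app x c) (app x b) xc<xb
    (subst (img x b <_) (sym (cong toℕ (app-involutive x b))) xb<b)
    (subst₂ _<_ (sym (cong toℕ (app-involutive x b))) (sym (cong toℕ (app-involutive x c))) (subst (toℕ b <_) (sym bc) (n<1+n _)))

  adjSwap-≤ : ∀ α {x} → x ≤ suc α → adjSwap α x ≤ suc α
  adjSwap-≤ α {x} x≤1+α with x ℕ.≟ α
  ... | yes _ = ≤-refl
  ... | no _ with x ℕ.≟ suc α
  ...   | yes _ = n≤1+n α
  ...   | no _  = x≤1+α

  adjSwap-≥ : ∀ α {x} → α ≤ x → α ≤ adjSwap α x
  adjSwap-≥ α {x} α≤x with x ℕ.≟ α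
  ... | yes _ = n≤1+n α
  ... | no _ with x ℕ.≟ suc α
  ...   | yes _ = ≤-refl
  ...   | no _  = α≤x

  module _ (u : Fpf n) (nonNesting : NonNesting u) {a b : Fin n} (s : IsSimple a b) (ua≢b : app u a ≢ b) where
    private
      v : Fpf n
      v = conj a b u
      α p q : ℕ
      α = toℕ a
      p = img u a
      q = img u b
      σ : ℕ → ℕ
      σ = adjSwap α

      img-v-other : ∀ {x} → x ≢ a → x ≢ b → img v x ≡ σ (img u x)
      img-v-other {x} x≢a x≢b = trans (cong (img v) (sym (swap-other a b x≢a x≢b))) (img-conj s u x)

      img-u-swap : ∀ x → img u (swap a b x) ≡ σ (img v x)
      img-u-swap x = subst (λ t → img t (swap a b x) ≡ σ (img v x)) (conj-involutive a b u) (img-conj s v x)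

      descent-away : p < q → ∀ {c d} → IsSimple c d → c ≢ a → c ≢ b → d ≢ a → d ≢ b → Descent u c d → Descent v c d
      descent-away p<q {c} {d} cd c≢a c≢b d≢a d≢b ud<uc =
        subst₂ _<_ (sym (img-v-other d≢a d≢b)) (sym (img-v-other c≢a c≢b)) (adjSwap-< α ud<uc ¬ab)
        where
        ¬ab : ¬ (img u d ≡ α × img u c ≡ suc α)
        ¬ab (ud≡α , uc≡1+α) = <-asym p<q (subst₂ _<_ (cong toℕ (img≡⇒≡app u (trans uc≡1+α (sym s))))
                                                      (trans (sym cd) (cong toℕ (img≡⇒≡app u ud≡α))) (n<1+n (toℕ c)))

      descentsPreserved : p < q → (∀ c → IsSimple c a → Descent u c a → Descent v c a) →
                          (∀ d → IsSimple b d → Descent u b d → Descent v b d) → DescentSubset u v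
      descentsPreserved p<q left right c d cd ud<uc with c ≟ a | c ≟ b | d ≟ a | d ≟ b
      ... | yes refl | _        | _        | _        = ⊥-elim (<-asym p<q (subst (λ t → img u t < p) (toℕ-injective (trans cd (sym s))) ud<uc))
      ... | no _     | yes refl | _        | _        = right d cd ud<uc
      ... | no _     | no _     | yes refl | _        = left c cd ud<uc
      ... | no c≢a   | no _     | no _     | yes refl = ⊥-elim (c≢a (toℕ-injective (suc-injective (trans (sym cd) s))))
      ... | no c≢a   | no c≢b   | no d≢a   | no d≢b   = descent-away p<q cd c≢a c≢b d≢a d≢b ud<uc

      descentsPreserved-outside : suc α < p → p < q → DescentSubset u v
      descentsPreserved-outside 1+α<p p<q = descentsPreserved p<q left right
        where
        left : ∀ c → IsSimple c a → Descent u c a → Descent v c a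
        left c ca p<uc = ⊥-elim (nonNesting c a (subst (toℕ c <_) (sym ca) (n<1+n _)) (<-trans (n<1+n α) 1+α<p) p<uc)
        right : ∀ d → IsSimple b d → Descent u b d → Descent v b d
        right d bd ud<q = subst₂ _<_ (sym (img-v-other d≢a d≢b)) (sym (img-conj-second s u ua≢b))
                                     (≤-<-trans (adjSwap-≤ α ud≤1+α) 1+α<p)
          where
          d≢a : d ≢ a
          d≢a refl = <-irrefl (trans bd (cong suc s)) (<-trans (n<1+n α) (n<1+n (suc α)))
          d≢b : d ≢ b
          d≢b refl = 1+n≢n (sym bd)
          ud<d : img u d < toℕ d
          ud<d with <-cmp (img u d) (toℕ d)
          ... | tri< ud<d _ _ = ud<d
          ... | tri≈ _ ud≡d _ = contradiction (toℕ-injective ud≡d) (app-fpf u d)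
          ... | tri> _ _ d<ud = ⊥-elim (nonNesting b d (subst (toℕ b <_) (sym bd) (n<1+n _)) d<ud ud<q)
          ud≤1+α : img u d ≤ suc α
          ud≤1+α = ≤-pred (subst (img u d <_) (trans bd (cong suc s)) ud<d)

      descentsPreserved-inside : p < q → q < α → DescentSubset u v
      descentsPreserved-inside p<q q<α = descentsPreserved p<q left right
        where
        uu : ∀ x → img u (app u x) ≡ toℕ x
        uu x = cong toℕ (app-involutive u x)
        right : ∀ d → IsSimple b d → Descent u b d → Descent v b d
        right d bd ud<q = ⊥-elim (nonNesting (app u d) (app u b) ud<q
                                   (subst (q <_) (sym (trans (uu b) s)) (<-trans q<α (n<1+n α)))
                                   (subst₂ _<_ (sym (trans (uu b) s)) (sym (trans (uu d) (trans bd (cong suc s)))) (n<1+n (suc α))))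
        left : ∀ c → IsSimple c a → Descent u c a → Descent v c a
        left c ca p<uc = subst₂ _<_ (sym (img-conj-first s u ua≢b)) (sym (img-v-other c≢a c≢b))
                                    (<-≤-trans q<α (adjSwap-≥ α α≤uc))
          where
          c≢a : c ≢ a
          c≢a refl = 1+n≢n (sym ca)
          c≢b : c ≢ b
          c≢b refl = <-irrefl (trans ca (cong suc s)) (<-trans (n<1+n α) (n<1+n (suc α)))
          c<uc : toℕ c < img u c
          c<uc with <-cmp (img u c) (toℕ c)
          ... | tri> _ _ c<uc = c<uc
          ... | tri≈ _ uc≡c _ = contradiction (toℕ-injective uc≡c) (app-fpf u c)
          ... | tri< uc<c _ _ = ⊥-elim (nonNesting (app u a) (app u c) p<uc (subst (img u c <_) (sym (uu c)) uc<c)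
                                          (subst₂ _<_ (sym (uu c)) (sym (uu a)) (subst (toℕ c <_) (sym ca) (n<1+n _))))
          α≤uc : α ≤ img u c
          α≤uc = subst (_≤ img u c) (sym ca) c<uc

    nonNesting-conj : ¬ DescentSubset u v → NonNesting v
    nonNesting-conj u⊈v i j i<j j<vj vj<vi
      with (toℕ i ℕ.≟ α) ×-dec (toℕ j ℕ.≟ suc α) | (img v j ℕ.≟ α) ×-dec (img v i ℕ.≟ suc α)
    ... | yes (i≡α , j≡1+α) | _ = u⊈v (descentsPreserved-outside 1+α<p p<q)
      where
      vj≡p : img v j ≡ p
      vj≡p = trans (cong (img v) (toℕ-injective (trans j≡1+α (sym s)))) (img-conj-second s u ua≢b)
      1+α<p : suc α < p
      1+α<p = subst₂ _<_ j≡1+α vj≡p j<vj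
      p<q : p < q
      p<q = subst₂ _<_ vj≡p (trans (cong (img v) (toℕ-injective i≡α)) (img-conj-first s u ua≢b)) vj<vi
    ... | no _ | yes (vj≡α , vi≡1+α) = u⊈v (descentsPreserved-inside p<q q<α)
      where
      i≡p : toℕ i ≡ p
      i≡p = trans (cong toℕ (img≡⇒≡app v (trans vi≡1+α (sym s)))) (img-conj-second s u ua≢b)
      j≡q : toℕ j ≡ q
      j≡q = trans (cong toℕ (img≡⇒≡app v vj≡α)) (img-conj-first s u ua≢b)
      p<q : p < q
      p<q = subst₂ _<_ i≡p j≡q i<j
      q<α : q < α
      q<α = subst₂ _<_ j≡q vj≡α j<vj
    ... | no ¬ab | no ¬vavb = nonNesting (swap a b i) (swap a b j)
      (subst₂ _<_ (sym (toℕ-swap s i)) (sym (toℕ-swap s j)) (adjSwap-< α i<j ¬ab))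
      (subst₂ _<_ (sym (toℕ-swap s j)) (sym (img-u-swap j)) (adjSwap-< α j<vj ¬fixed))
      (subst₂ _<_ (sym (img-u-swap j)) (sym (img-u-swap i)) (adjSwap-< α vj<vi ¬vavb))
      where
      ¬fixed : ¬ (toℕ j ≡ α × img v j ≡ suc α)
      ¬fixed (j≡α , vj≡1+α) = conj-notFixed s u ua≢b
        (trans (cong (app v) (toℕ-injective (sym j≡α))) (toℕ-injective (trans vj≡1+α (sym s))))

module HeckeModule where

  open Involutions
  open import Data.Integer using (ℤ; +_; -[1+_]; 0ℤ; 1ℤ; -1ℤ; _+_; _-_; -_; _*_)
  import Data.Integer as ℤ
  import Data.Integer.Properties as ℤ
  open import Data.Integer.Tactic.RingSolver using (solve-∀)
  open import Data.Nat using (zero; suc; s≤s; z≤n; z<s; _<_; _≮_; _<ᵇ_; _⊔_)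
  import Data.Nat.Properties as ℕ
  import Data.Nat as ℕ
  open import Data.Nat.Properties using (_≤?_; ≰⇒>; m≤m⊔n; m≤n⊔m; <-irrefl; <-asym; m<n+m; m≤n+m; <⇒≤; <⇒≱; <-≤-trans; ≤-refl; ≤-trans; +-cancelˡ-≤)

  fixedBy≡ : (a b : Fin n) (w : Fpf n) → fixedBy a b w ≡ does (conj a b w ≟ᶠ w)
  fixedBy≡ a b w = isYes≗does (Vec.≡-dec _≟_ (perm (conj a b w)) (perm w))

  hecke-fixed : {a b : Fin n} (f : Mod n) {w : Fpf n} → app w a ≡ b → ∀ k → hecke a b f w k ≡ f w (k - 1ℤ)
  hecke-fixed {a = a} {b} f {w} wa≡b k = if-cong (trans (fixedBy≡ a b w) (dec-true (conj a b w ≟ᶠ w) (conj-fixed a b w wa≡b)))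

  module _ {a b : Fin n} (s : IsSimple a b) (f : Mod n) (w : Fpf n) (wa≢b : app w a ≢ b) where

    private
      moved : len (conj a b w) ≡ 2 ℕ.+ len w ⊎ len w ≡ 2 ℕ.+ len (conj a b w) → conj a b w ≢ w
      moved (inj₁ up)   sws≡w = <-irrefl (trans (cong len (sym sws≡w)) up) (m<n+m _ {2} z<s)
      moved (inj₂ down) sws≡w = <-irrefl (trans (cong len sws≡w) down) (m<n+m _ {2} z<s)

    hecke-ascent : img w a < img w b → ∀ k → hecke a b f w k ≡ f (conj a b w) k
    hecke-ascent wa<wb k = begin
      hecke a b f w k
        ≡⟨ if-cong (trans (fixedBy≡ a b w) (dec-false (conj a b w ≟ᶠ w) (moved (inj₁ up)))) ⟩
      f (conj a b w) k + (if len (conj a b w) <ᵇ len w then f w (k - 1ℤ) - f w (k + 1ℤ) else 0ℤ)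
        ≡⟨ cong (λ t → f (conj a b w) k + t) (if-cong (<ᵇ-false (subst (_≮ len w) (sym up) (<-asym (m<n+m _ {2} z<s))))) ⟩
      f (conj a b w) k + 0ℤ
        ≡⟨ ℤ.+-identityʳ _ ⟩
      f (conj a b w) k ∎
      where
      open ≡-Reasoning
      up : len (conj a b w) ≡ 2 ℕ.+ len w
      up = len-conj-ascent s w wa≢b wa<wb

    hecke-descent : Descent w a b → ∀ k → hecke a b f w k ≡ f (conj a b w) k + (f w (k - 1ℤ) - f w (k + 1ℤ))
    hecke-descent d k = trans (if-cong (trans (fixedBy≡ a b w) (dec-false (conj a b w ≟ᶠ w) (moved (inj₂ down)))))
                              (cong (λ t → f (conj a b w) k + t) (if-cong (<ᵇ-true (subst (len (conj a b w) <_) (sym down) (m<n+m _ {2} z<s)))))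
      where
      down : len w ≡ 2 ℕ.+ len (conj a b w)
      down = len-conj-descent s w wa≢b d

  hecke-cong : (a b : Fin n) {f g : Mod n} → f ≐ g → hecke a b f ≐ hecke a b g
  hecke-cong a b f≐g w k with fixedBy a b w | len (conj a b w) <ᵇ len w
  ... | true  | _     = f≐g w _
  ... | false | true  = cong₂ _+_ (f≐g _ k) (cong₂ _-_ (f≐g w _) (f≐g w _))
  ... | false | false = cong (_+ 0ℤ) (f≐g _ k)

  0ᴹ : Mod n
  0ᴹ _ _ = 0ℤ

  _⊖_ : Mod n → Mod n → Mod n
  (f ⊖ g) w k = f w k - g w k

  scale : ℤ → Mod n → Mod n
  scale c f w k = c * f w k

  vpow : ℤ → Mod n → Mod n
  vpow j f w k = f w (k - j)

  monomial : Fpf n → ℤ → ℤ → Mod n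
  monomial t j c = scale c (vpow j (basis t))

  basis-other : {t w : Fpf n} → w ≢ t → ∀ k → basis t w k ≡ 0ℤ
  basis-other {t = t} {w} w≢t k with Vec.≡-dec _≟_ (perm w) (perm t)
  ... | yes w≡t = contradiction (Fpf-≡ w≡t) w≢t
  ... | no _    = refl

  basis-offDegree : (t w : Fpf n) {k : ℤ} → k ≢ 0ℤ → basis t w k ≡ 0ℤ
  basis-offDegree t w {k} k≢0 with Vec.≡-dec _≟_ (perm w) (perm t) | k ℤ.≟ 0ℤ
  ... | yes _ | yes k≡0 = contradiction k≡0 k≢0
  ... | yes _ | no _    = refl
  ... | no _  | _       = refl

  basis-self : (t : Fpf n) → basis t t 0ℤ ≡ 1ℤ
  basis-self t with Vec.≡-dec _≟_ (perm t) (perm t) | 0ℤ ℤ.≟ 0ℤ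
  ... | yes _   | yes _   = refl
  ... | yes _   | no 0≢0 = contradiction refl 0≢0
  ... | no t≢t | _       = contradiction refl t≢t

  basis-neg : (t w : Fpf n) (k : ℤ) → basis t w (- k) ≡ basis t w k
  basis-neg t w k with Vec.≡-dec _≟_ (perm w) (perm t) | k ℤ.≟ 0ℤ | - k ℤ.≟ 0ℤ
  ... | no _  | _        | _         = refl
  ... | yes _ | yes _    | yes _     = refl
  ... | yes _ | no _     | no _      = refl
  ... | yes _ | yes refl | no -0≢0  = contradiction refl -0≢0
  ... | yes _ | no k≢0   | yes -k≡0 = contradiction (trans (sym (ℤ.neg-involutive k)) (cong -_ -k≡0)) k≢0

  basis-diag : (t u : Fpf n) (k : ℤ) → basis t t k ≡ basis u u k
  basis-diag t u k with Vec.≡-dec _≟_ (perm t) (perm t) | Vec.≡-dec _≟_ (perm u) (perm u) | k ℤ.≟ 0ℤ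
  ... | yes _   | yes _   | yes _ = refl
  ... | yes _   | yes _   | no _  = refl
  ... | no t≢t | _       | _     = contradiction refl t≢t
  ... | _       | no u≢u | _     = contradiction refl u≢u

  basis-conj : (a b : Fin n) (t w : Fpf n) (k : ℤ) → basis (conj a b t) (conj a b w) k ≡ basis t w k
  basis-conj a b t w k with w ≟ᶠ t
  ... | yes refl = basis-diag (conj a b w) w k
  ... | no w≢t   = trans (basis-other (w≢t ∘ conj-injective a b) k) (sym (basis-other w≢t k))

  monomial-other : (t w : Fpf n) (j c k : ℤ) → w ≢ t → monomial t j c w k ≡ 0ℤ
  monomial-other t w j c k w≢t = trans (cong (c *_) (basis-other w≢t (k - j))) (ℤ.*-zeroʳ c)

  monomial-offDegree : (t w : Fpf n) (j c k : ℤ) → k ≢ j → monomial t j c w k ≡ 0ℤ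
  monomial-offDegree t w j c k k≢j = trans (cong (c *_) (basis-offDegree t w (k≢j ∘ ℤ.i-j≡0⇒i≡j k j))) (ℤ.*-zeroʳ c)

  monomial-self : (t : Fpf n) (j c : ℤ) → monomial t j c t j ≡ c
  monomial-self t j c = begin
    c * basis t t (j - j)  ≡⟨ cong (λ d → c * basis t t d) (ℤ.+-inverseʳ j) ⟩
    c * basis t t 0ℤ       ≡⟨ cong (c *_) (basis-self t) ⟩
    c * 1ℤ                 ≡⟨ ℤ.*-identityʳ c ⟩
    c                      ∎
    where open ≡-Reasoning

  restrict remove : Fpf n → Mod n → Mod n
  restrict t f w k = if does (w ≟ᶠ t) then f w k else 0ℤ
  remove   t f w k = if does (w ≟ᶠ t) then 0ℤ else f w k

  restrict⊕remove : (t : Fpf n) (f : Mod n) → (restrict t f ⊕ remove t f) ≐ f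
  restrict⊕remove t f w k with does (w ≟ᶠ t)
  ... | true  = ℤ.+-identityʳ (f w k)
  ... | false = ℤ.+-identityˡ (f w k)

  restrict-other : {t w : Fpf n} (f : Mod n) → w ≢ t → ∀ k → restrict t f w k ≡ 0ℤ
  restrict-other {t = t} {w} f w≢t k = if-cong (dec-false (w ≟ᶠ t) w≢t)

  remove-self : (t : Fpf n) (f : Mod n) → ∀ k → remove t f t k ≡ 0ℤ
  remove-self t f k = if-cong (dec-true (t ≟ᶠ t) refl)

  restrict-zero : (t : Fpf n) (f : Mod n) {w : Fpf n} {k : ℤ} → f w k ≡ 0ℤ → restrict t f w k ≡ 0ℤ
  restrict-zero t f {w} fwk≡0 with does (w ≟ᶠ t)
  ... | true  = fwk≡0
  ... | false = refl

  remove-zero : (t : Fpf n) (f : Mod n) {w : Fpf n} {k : ℤ} → f w k ≡ 0ℤ → remove t f w k ≡ 0ℤ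
  remove-zero t f {w} fwk≡0 with does (w ≟ᶠ t)
  ... | true  = refl
  ... | false = fwk≡0

  restrict-vanishing : (t : Fpf n) (f : Mod n) → (∀ k → f t k ≡ 0ℤ) → ∀ w k → restrict t f w k ≡ 0ℤ
  restrict-vanishing t f ft≡0 w k with w ≟ᶠ t
  ... | yes refl = restrict-zero t f (ft≡0 k)
  ... | no w≢t   = restrict-other f w≢t k

  FiniteDegrees : Mod n → Set
  FiniteDegrees f = ∀ t → ∃[ K ] ∀ k → k ∉ K → f t k ≡ 0ℤ

  VanishesAbove : ℕ → Mod n → Set
  VanishesAbove N f = ∀ t k → N < len t → f t k ≡ 0ℤ

  -- The bar involution

  private
    [x+y]-y≡x : ∀ x y → x + y - y ≡ x
    [x+y]-y≡x = solve-∀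

    [x-y]+y≡x : ∀ x y → x - y + y ≡ x
    [x-y]+y≡x = solve-∀

    x≡x+x⇒x≡0 : ∀ {x} → x ≡ x + x → x ≡ 0ℤ
    x≡x+x⇒x≡0 {x} x≡x+x = begin
      x           ≡⟨ [x+y]-y≡x x x ⟨
      x + x - x   ≡⟨ cong (_- x) x≡x+x ⟨
      x - x       ≡⟨ ℤ.+-inverseʳ x ⟩
      0ℤ          ∎
      where open ≡-Reasoning

  module _ {z0 : Fpf n} {ψ : Mod n → Mod n} (bar : IsBarInvolution z0 ψ) where
    open IsBarInvolution bar

    ψ-0 : ψ 0ᴹ ≐ 0ᴹ
    ψ-0 w k = x≡x+x⇒x≡0 (trans (respects 0ᴹ (0ᴹ ⊕ 0ᴹ) (λ _ _ → refl) w k) (additive 0ᴹ 0ᴹ w k))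

    ψ-⊖ : ∀ f g → ψ (f ⊖ g) ≐ (ψ f ⊖ ψ g)
    ψ-⊖ f g w k = begin
      ψ (f ⊖ g) w k                     ≡⟨ [x+y]-y≡x _ _ ⟨
      ψ (f ⊖ g) w k + ψ g w k - ψ g w k ≡⟨ cong (_- ψ g w k) (additive (f ⊖ g) g w k) ⟨
      ψ ((f ⊖ g) ⊕ g) w k - ψ g w k     ≡⟨ cong (_- ψ g w k) (respects _ f (λ w k → [x-y]+y≡x (f w k) (g w k)) w k) ⟩
      ψ f w k - ψ g w k                 ∎
      where open ≡-Reasoning

    ψ-scale⁺ : ∀ m f → ψ (scale (+ m) f) ≐ scale (+ m) (ψ f)
    ψ-scale⁺ zero f w k = begin
      ψ (scale 0ℤ f) w k ≡⟨ respects _ 0ᴹ (λ w k → ℤ.*-zeroˡ (f w k)) w k ⟩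
      ψ 0ᴹ w k           ≡⟨ ψ-0 w k ⟩
      0ℤ                 ≡⟨ ℤ.*-zeroˡ (ψ f w k) ⟨
      0ℤ * ψ f w k       ∎
      where open ≡-Reasoning
    ψ-scale⁺ (suc m) f w k = begin
      ψ (scale (+ suc m) f) w k           ≡⟨ respects _ (f ⊕ scale (+ m) f) (λ w k → 1+m*x≡x+m*x (+ m) (f w k)) w k ⟩
      ψ (f ⊕ scale (+ m) f) w k           ≡⟨ additive f _ w k ⟩
      ψ f w k + ψ (scale (+ m) f) w k     ≡⟨ cong (λ t → ψ f w k + t) (ψ-scale⁺ m f w k) ⟩
      ψ f w k + + m * ψ f w k             ≡⟨ 1+m*x≡x+m*x (+ m) (ψ f w k) ⟨
      + suc m * ψ f w k                   ∎
      where
      open ≡-Reasoning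
      1+m*x≡x+m*x : ∀ m x → (1ℤ + m) * x ≡ x + m * x
      1+m*x≡x+m*x = solve-∀

    ψ-scale : ∀ c f → ψ (scale c f) ≐ scale c (ψ f)
    ψ-scale (+ m)    f = ψ-scale⁺ m f
    ψ-scale -[1+ m ] f w k = begin
      ψ (scale -[1+ m ] f) w k              ≡⟨ respects _ (0ᴹ ⊖ scale (+ suc m) f) (λ w k → neg-scale (+ suc m) (f w k)) w k ⟩
      ψ (0ᴹ ⊖ scale (+ suc m) f) w k        ≡⟨ ψ-⊖ 0ᴹ _ w k ⟩
      ψ 0ᴹ w k - ψ (scale (+ suc m) f) w k  ≡⟨ cong₂ _-_ (ψ-0 w k) (ψ-scale⁺ (suc m) f w k) ⟩
      0ℤ - + suc m * ψ f w k                ≡⟨ neg-scale (+ suc m) (ψ f w k) ⟨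
      -[1+ m ] * ψ f w k                    ∎
      where
      open ≡-Reasoning
      neg-scale : ∀ c x → (- c) * x ≡ 0ℤ - c * x
      neg-scale = solve-∀

    ψ-vpow⁺ : ∀ m f → ψ (vpow (+ m) f) ≐ vpow (- (+ m)) (ψ f)
    ψ-vpow⁺ zero f w k = begin
      ψ (vpow 0ℤ f) w k  ≡⟨ respects _ f (λ w k → cong (f w) (ℤ.+-identityʳ k)) w k ⟩
      ψ f w k            ≡⟨ cong (ψ f w) (ℤ.+-identityʳ k) ⟨
      ψ f w (k - 0ℤ)     ∎
      where open ≡-Reasoning
    ψ-vpow⁺ (suc m) f w k = begin
      ψ (vpow (+ suc m) f) w k          ≡⟨ respects _ (vmul (vpow (+ m) f)) (λ w k → cong (f w) (k-[1+c]≡k-1-c k (+ m))) w k ⟩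
      ψ (vmul (vpow (+ m) f)) w k       ≡⟨ semilin _ w k ⟩
      ψ (vpow (+ m) f) w (k + 1ℤ)       ≡⟨ ψ-vpow⁺ m f w (k + 1ℤ) ⟩
      ψ f w (k + 1ℤ - - (+ m))          ≡⟨ cong (ψ f w) (k+1--c≡k--[1+c] k (+ m)) ⟩
      ψ f w (k - - (+ suc m))           ∎
      where
      open ≡-Reasoning
      k-[1+c]≡k-1-c : ∀ k c → k - (1ℤ + c) ≡ k - 1ℤ - c
      k-[1+c]≡k-1-c = solve-∀
      k+1--c≡k--[1+c] : ∀ k c → k + 1ℤ - - c ≡ k - - (1ℤ + c)
      k+1--c≡k--[1+c] = solve-∀

    ψ-vpow : ∀ j f → ψ (vpow j f) ≐ vpow (- j) (ψ f)
    ψ-vpow (+ m)    f = ψ-vpow⁺ m f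
    ψ-vpow -[1+ m ] f w k = begin
      ψ h w k                      ≡⟨ cong (ψ h w) (k-c--c≡k k c) ⟨
      ψ h w (k - c - - c)          ≡⟨ ψ-vpow⁺ (suc m) h w (k - c) ⟨
      ψ (vpow c h) w (k - c)       ≡⟨ respects (vpow c h) f (λ w k → cong (f w) (k-c--c≡k k c)) w (k - c) ⟩
      ψ f w (k - c)                ∎
      where
      open ≡-Reasoning
      c : ℤ
      c = + suc m
      h : Mod n
      h = vpow -[1+ m ] f
      k-c--c≡k : ∀ k c → k - c - - c ≡ k
      k-c--c≡k = solve-∀

  basis-conj-moved : (a b : Fin n) (u w : Fpf n) (k : ℤ) → basis u (conj a b w) k ≡ basis (conj a b u) w k
  basis-conj-moved a b u w k = begin
    basis u (conj a b w) k                       ≡⟨ basis-conj a b u (conj a b w) k ⟨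
    basis (conj a b u) (conj a b (conj a b w)) k ≡⟨ cong (λ t → basis (conj a b u) t k) (conj-involutive a b w) ⟩
    basis (conj a b u) w k                       ∎
    where open ≡-Reasoning

  hecke-basis-ascent : IsSimple a b → (u : Fpf n) → app u a ≢ b → img u a < img u b →
                       hecke a b (basis u) ≐ basis (conj a b u)
  hecke-basis-ascent {a = a} {b} s u ua≢b ua<ub w k with position s w
  ... | fixed wa≡b = begin
    hecke a b (basis u) w k  ≡⟨ hecke-fixed (basis u) wa≡b k ⟩
    basis u w (k - 1ℤ)       ≡⟨ basis-other w≢u _ ⟩
    0ℤ                       ≡⟨ basis-other w≢su k ⟨
    basis (conj a b u) w k   ∎
    where
    open ≡-Reasoning
    w≢u : w ≢ u
    w≢u refl = ua≢b wa≡b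
    w≢su : w ≢ conj a b u
    w≢su refl = conj-notFixed s u ua≢b wa≡b
  ... | ascent wa≢b wa<wb = trans (hecke-ascent s (basis u) w wa≢b wa<wb k) (basis-conj-moved a b u w k)
  ... | descent wa≢b wb<wa = begin
    hecke a b (basis u) w k                                                    ≡⟨ hecke-descent s (basis u) w wa≢b wb<wa k ⟩
    basis u (conj a b w) k + (basis u w (k - 1ℤ) - basis u w (k + 1ℤ))        ≡⟨ cong₂ _+_ (basis-conj-moved a b u w k)
                                                                                   (cong₂ _-_ (basis-other w≢u _) (basis-other w≢u _)) ⟩
    basis (conj a b u) w k + 0ℤ                                                ≡⟨ ℤ.+-identityʳ _ ⟩
    basis (conj a b u) w k                                                     ∎
    where
    open ≡-Reasoning
    w≢u : w ≢ u
    w≢u refl = <-asym ua<ub wb<wa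

  AgreesAbove : Mod n → Fpf n → Set
  AgreesAbove g u = ∀ w k → len u ≤ len w → g w k ≡ basis u w k

  agreesAbove⇒vanishes : {g : Mod n} {u : Fpf n} → AgreesAbove g u → ∀ w k → len u < len w → g w k ≡ 0ℤ
  agreesAbove⇒vanishes {u = u} agrees w k len-u<w =
    trans (agrees w k (<⇒≤ len-u<w)) (basis-other (λ { refl → <-irrefl refl len-u<w }) k)

  module _ {a b : Fin n} (s : IsSimple a b) (u : Fpf n) (ua≢b : app u a ≢ b) (d : Descent u a b) where
    private
      u′ : Fpf n
      u′ = conj a b u
      len-u : len u ≡ 2 ℕ.+ len u′
      len-u = len-conj-descent s u ua≢b d
      len-u′<u : len u′ < len u
      len-u′<u = subst (len u′ <_) (sym len-u) (m<n+m _ {2} z<s)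

    hecke-agreesAbove : {g : Mod n} → AgreesAbove g (conj a b u) → AgreesAbove (hecke a b g) u
    hecke-agreesAbove {g} agrees w k len-u≤w with position s w
    ... | fixed wa≡b = begin
      hecke a b g w k    ≡⟨ hecke-fixed g wa≡b k ⟩
      g w (k - 1ℤ)       ≡⟨ agreesAbove⇒vanishes agrees w _ (<-≤-trans len-u′<u len-u≤w) ⟩
      0ℤ                 ≡⟨ basis-other w≢u k ⟨
      basis u w k        ∎
      where
      open ≡-Reasoning
      w≢u : w ≢ u
      w≢u refl = ua≢b wa≡b
    ... | ascent wa≢b wa<wb = begin
      hecke a b g w k            ≡⟨ hecke-ascent s g w wa≢b wa<wb k ⟩
      g (conj a b w) k           ≡⟨ agrees (conj a b w) k len-u′≤sws ⟩
      basis u′ (conj a b w) k    ≡⟨ basis-conj a b u w k ⟩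
      basis u w k                ∎
      where
      open ≡-Reasoning
      len-u′≤sws : len u′ ≤ len (conj a b w)
      len-u′≤sws = subst (len u′ ≤_) (sym (len-conj-ascent s w wa≢b wa<wb))
                         (≤-trans (<⇒≤ len-u′<u) (≤-trans len-u≤w (m≤n+m _ 2)))
    ... | descent wa≢b wb<wa = begin
      hecke a b g w k                                    ≡⟨ hecke-descent s g w wa≢b wb<wa k ⟩
      g (conj a b w) k + (g w (k - 1ℤ) - g w (k + 1ℤ))   ≡⟨ cong₂ _+_ (agrees (conj a b w) k len-u′≤sws)
                                                                    (cong₂ _-_ (vanishes (k - 1ℤ)) (vanishes (k + 1ℤ))) ⟩
      basis u′ (conj a b w) k + 0ℤ                       ≡⟨ ℤ.+-identityʳ _ ⟩
      basis u′ (conj a b w) k                            ≡⟨ basis-conj a b u w k ⟩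
      basis u w k                                        ∎
      where
      open ≡-Reasoning
      vanishes : ∀ j → g w j ≡ 0ℤ
      vanishes j = agreesAbove⇒vanishes agrees w j (<-≤-trans len-u′<u len-u≤w)
      len-u′≤sws : len u′ ≤ len (conj a b w)
      len-u′≤sws = +-cancelˡ-≤ 2 _ _ (subst₂ _≤_ len-u (len-conj-descent s w wa≢b wb<wa) len-u≤w)

  module BarInvolution {z0 : Fpf n} (z0-base : IsBase z0) {ψ : Mod n → Mod n} (bar : IsBarInvolution z0 ψ) where
    open IsBarInvolution bar

    TriangularAt : Fpf n → Set
    TriangularAt u = AgreesAbove (ψ (basis u)) u

    triangular-descent : IsSimple a b → (u : Fpf n) → app u a ≢ b → Descent u a b →
                         TriangularAt (conj a b u) → TriangularAt u
    triangular-descent {a = a} {b} s u ua≢b d triangular-u′ w k len-u≤w = begin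
      ψ (basis u) w k                                ≡⟨ respects _ _ (λ w k → sym (hecke-basis-u′ w k)) w k ⟩
      ψ (hecke a b (basis u′)) w k                   ≡⟨ compat a b s (basis u′) w k ⟩
      hecke a b g w k - g w (k - 1ℤ) + g w (k + 1ℤ)  ≡⟨ cong₂ (λ x y → hecke a b g w k - x + y) (vanishes (k - 1ℤ)) (vanishes (k + 1ℤ)) ⟩
      hecke a b g w k - 0ℤ + 0ℤ                      ≡⟨ trans (ℤ.+-identityʳ _) (ℤ.+-identityʳ _) ⟩
      hecke a b g w k                                ≡⟨ hecke-agreesAbove s u ua≢b d triangular-u′ w k len-u≤w ⟩
      basis u w k                                    ∎
      where
      open ≡-Reasoning
      u′ : Fpf n
      u′ = conj a b u
      g : Mod n
      g = ψ (basis u′)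
      hecke-basis-u′ : hecke a b (basis u′) ≐ basis u
      hecke-basis-u′ w k = trans (hecke-basis-ascent s u′ (conj-notFixed s u ua≢b) (ascent-conj s u ua≢b d) w k)
                                 (cong (λ t → basis t w k) (conj-involutive a b u))
      vanishes : ∀ j → g w j ≡ 0ℤ
      vanishes j = agreesAbove⇒vanishes triangular-u′ w j
        (<-≤-trans (subst (len u′ <_) (sym (len-conj-descent s u ua≢b d)) (m<n+m _ {2} z<s)) len-u≤w)

    ψ-basis-triangular : ∀ u → TriangularAt u
    ψ-basis-triangular u = byLength (suc (len u)) u ≤-refl
      where
      byLength : ∀ bound u → len u < bound → TriangularAt u
      byLength (suc bound) u (s≤s len-u≤bound) with properDescent? u
      ... | yes (a , b , s , d , ua≢b) = triangular-descent s u ua≢b d (byLength bound (conj a b u) len-u′<bound)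
        where
        len-u′<bound : len (conj a b u) < bound
        len-u′<bound = <-≤-trans (subst (len (conj a b u) <_) (sym (len-conj-descent s u ua≢b d)) (m<n+m _ {2} z<s)) len-u≤bound
      ... | no none = subst TriangularAt (sym (noProperDescent⇒base none z0-base)) (λ w k _ → fixesBase w k)

    Reflected : ℕ → Mod n → Set
    Reflected N f = ∀ w k → N ≤ len w → ψ f w k ≡ f w (- k)

    reflected-0 : ∀ {N} → Reflected N 0ᴹ
    reflected-0 w k _ = ψ-0 bar w k

    reflected-⊕ : ∀ {N f g} → Reflected N f → Reflected N g → Reflected N (f ⊕ g)
    reflected-⊕ {f = f} {g} ref-f ref-g w k N≤w = trans (additive f g w k) (cong₂ _+_ (ref-f w k N≤w) (ref-g w k N≤w))

    reflected-≐ : ∀ {N f g} → f ≐ g → Reflected N f → Reflected N g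
    reflected-≐ {f = f} {g} f≐g ref-f w k N≤w = trans (respects g f (λ w k → sym (f≐g w k)) w k) (trans (ref-f w k N≤w) (f≐g w (- k)))

    reflected-monomial : ∀ {N t} j c → len t ≤ N → Reflected N (monomial t j c)
    reflected-monomial {t = t} j c len-t≤N w k N≤w = begin
      ψ (scale c (vpow j (basis t))) w k  ≡⟨ ψ-scale bar c _ w k ⟩
      c * ψ (vpow j (basis t)) w k        ≡⟨ cong (c *_) (ψ-vpow bar j _ w k) ⟩
      c * ψ (basis t) w (k - - j)         ≡⟨ cong (c *_) (ψ-basis-triangular t w _ (≤-trans len-t≤N N≤w)) ⟩
      c * basis t w (k - - j)             ≡⟨ cong (c *_) (basis-neg t w _) ⟨
      c * basis t w (- (k - - j))         ≡⟨ cong (λ d → c * basis t w d) (-[k--j]≡-k-j k j) ⟩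
      c * basis t w (- k - j)             ∎
      where
      open ≡-Reasoning
      -[k--j]≡-k-j : ∀ k j → - (k - - j) ≡ - k - j
      -[k--j]≡-k-j = solve-∀

    reflected-at : ∀ {N} (t : Fpf n) (K : List ℤ) (g : Mod n) → len t ≤ N →
                   (∀ w k → w ≢ t → g w k ≡ 0ℤ) → (∀ k → k ∉ K → g t k ≡ 0ℤ) → Reflected N g
    reflected-at t [] g _ off-t off-K = reflected-≐ 0≐g reflected-0
      where
      0≐g : 0ᴹ ≐ g
      0≐g w k with w ≟ᶠ t
      ... | yes refl = sym (off-K k λ ())
      ... | no w≢t   = sym (off-t w k w≢t)
    reflected-at t (j ∷ K) g len-t≤N off-t off-K =
      reflected-≐ p⊕g′≐g (reflected-⊕ (reflected-monomial j (g t j) len-t≤N) (reflected-at t K g′ len-t≤N off-t′ off-K′))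
      where
      p g′ : Mod n
      p = monomial t j (g t j)
      g′ = g ⊖ p
      p⊕g′≐g : (p ⊕ g′) ≐ g
      p⊕g′≐g w k = y+[x-y]≡x (g w k) (p w k)
        where
        y+[x-y]≡x : ∀ x y → y + (x - y) ≡ x
        y+[x-y]≡x = solve-∀
      off-t′ : ∀ w k → w ≢ t → g′ w k ≡ 0ℤ
      off-t′ w k w≢t = cong₂ _-_ (off-t w k w≢t) (monomial-other t w j (g t j) k w≢t)
      off-K′ : ∀ k → k ∉ K → g′ t k ≡ 0ℤ
      off-K′ k k∉K with k ℤ.≟ j
      ... | yes refl = trans (cong (λ x → g t k - x) (monomial-self t k (g t k))) (ℤ.+-inverseʳ (g t k))
      ... | no k≢j   = cong₂ _-_ (off-K k λ { (here k≡j) → k≢j k≡j ; (there k∈K) → k∉K k∈K })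
                                 (monomial-offDegree t t j (g t j) k k≢j)

    reflected-restrict : ∀ {N} (t : Fpf n) (f : Mod n) → VanishesAbove N f → FiniteDegrees f → Reflected N (restrict t f)
    reflected-restrict {N} t f vanish finite with len t ≤? N
    ... | yes len-t≤N = reflected-at t (proj₁ (finite t)) (restrict t f) len-t≤N
                                     (λ w k w≢t → restrict-other f w≢t k)
                                     (λ k k∉K → restrict-zero t f (proj₂ (finite t) k k∉K))
    ... | no len-t≰N  = reflected-≐ (λ w k → sym (restrict-vanishing t f (λ k → vanish t k (≰⇒> len-t≰N)) w k)) reflected-0

    reflected-list : ∀ {N} (L : List (Fpf n)) (f : Mod n) → VanishesAbove N f → FiniteDegrees f →
                     (∀ t → t ∉ L → ∀ k → f t k ≡ 0ℤ) → Reflected N f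
    reflected-list [] f _ _ off-L = reflected-≐ (λ w k → sym (off-L w (λ ()) k)) reflected-0
    reflected-list (t ∷ L) f vanish finite off-L =
      reflected-≐ (restrict⊕remove t f) (reflected-⊕ (reflected-restrict t f vanish finite) (reflected-list L (remove t f) vanish′ finite′ off-L′))
      where
      vanish′ : VanishesAbove _ (remove t f)
      vanish′ w k N<w = remove-zero t f (vanish w k N<w)
      finite′ : FiniteDegrees (remove t f)
      finite′ w = proj₁ (finite w) , λ k k∉K → remove-zero t f (proj₂ (finite w) k k∉K)
      off-L′ : ∀ w → w ∉ L → ∀ k → remove t f w k ≡ 0ℤ
      off-L′ w w∉L k with w ≟ᶠ t
      ... | yes refl = remove-self w f k
      ... | no w≢t   = remove-zero t f (off-L w (λ { (here w≡t) → w≢t w≡t ; (there w∈L) → w∉L w∈L }) k)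

    reflected : ∀ {N} (f : Mod n) → VanishesAbove N f → FiniteDegrees f → Reflected N f
    reflected f vanish finite = reflected-list (allFpf _) f vanish finite (λ t t∉ → contradiction (∈-allFpf t) t∉)

  -- The canonical basis

  module CanonicalBasis {z0 : Fpf n} (z0-base : IsBase z0) {ψ : Mod n → Mod n} (bar : IsBarInvolution z0 ψ)
                        {cb : Fpf n → Mod n} (canonical : IsCanonicalBasis ψ cb) where
    open IsBarInvolution bar
    open IsCanonicalBasis canonical
    open BarInvolution z0-base bar

    module _ (y : Fpf n) {a b : Fin n} (s : IsSimple a b) (y-descent : Descent y a b) where
      private
        C : Mod n
        C = cb y

      D : Mod n
      D = hecke a b C ⊖ vmul C

      C-nonneg : ∀ {w} m → w ≢ y → C w (+ m) ≡ 0ℤ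
      C-nonneg {w} m w≢y = negDegrees y w w≢y (+ m) (ℤ.+≤+ z≤n)

      C-pos : ∀ w m → C w (+ suc m) ≡ 0ℤ
      C-pos w m with w ≟ᶠ y
      ... | yes refl = trans (diagonal y _) (basis-offDegree y y λ ())
      ... | no w≢y   = C-nonneg (suc m) w≢y

      ascent≢y : ∀ {w} → img w a < img w b → w ≢ y
      ascent≢y wa<wb refl = <-asym wa<wb y-descent

      D-fixed : ∀ {w} → app w a ≡ b → ∀ k → D w k ≡ 0ℤ
      D-fixed {w} wa≡b k = trans (cong (_- C w (k - 1ℤ)) (hecke-fixed C wa≡b k)) (ℤ.+-inverseʳ (C w (k - 1ℤ)))

      D-pos : ∀ w m → D w (+ suc m) ≡ 0ℤ
      D-pos w m with position s w
      ... | fixed wa≡b = D-fixed wa≡b _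
      ... | ascent wa≢b wa<wb = cong₂ _-_ (trans (hecke-ascent s C w wa≢b wa<wb _) (C-pos _ m))
                                          (trans (cong (C w) (1+m-1≡m (+ m))) (C-nonneg m (ascent≢y wa<wb)))
        where
        1+m-1≡m : ∀ m → 1ℤ + m - 1ℤ ≡ m
        1+m-1≡m = solve-∀
      ... | descent wa≢b wb<wa = begin
        D w (+ suc m)                                                   ≡⟨ cong (_- C w (+ suc m - 1ℤ)) (hecke-descent s C w wa≢b wb<wa _) ⟩
        C sws (+ suc m) + (C w (+ suc m - 1ℤ) - C w (+ suc m + 1ℤ)) - C w (+ suc m - 1ℤ)
                                                                        ≡⟨ p+[q-r]-q≡p-r (C sws (+ suc m)) (C w (+ suc m - 1ℤ)) (C w (+ suc m + 1ℤ)) ⟩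
        C sws (+ suc m) - C w (+ suc m + 1ℤ)                            ≡⟨ cong₂ _-_ (C-pos sws m) (trans (cong (C w ∘ +_) (ℕ.+-comm (suc m) 1)) (C-pos w (suc m))) ⟩
        0ℤ                                                              ∎
        where
        open ≡-Reasoning
        sws : Fpf n
        sws = conj a b w
        p+[q-r]-q≡p-r : ∀ p q r → p + (q - r) - q ≡ p - r
        p+[q-r]-q≡p-r = solve-∀

      D-zero-descent : ∀ {w} → app w a ≢ b → Descent w a b → D w 0ℤ ≡ 0ℤ
      D-zero-descent {w} wa≢b wb<wa = begin
        D w 0ℤ                                                  ≡⟨ cong (_- C w -1ℤ) (hecke-descent s C w wa≢b wb<wa 0ℤ) ⟩
        C sws 0ℤ + (C w -1ℤ - C w 1ℤ) - C w -1ℤ                  ≡⟨ p+[q-r]-q≡p-r (C sws 0ℤ) (C w -1ℤ) (C w 1ℤ) ⟩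
        C sws 0ℤ - C w 1ℤ                                       ≡⟨ cong₂ _-_ (C-nonneg 0 (ascent≢y (ascent-conj s w wa≢b wb<wa))) (C-pos w 0) ⟩
        0ℤ                                                      ∎
        where
        open ≡-Reasoning
        sws : Fpf n
        sws = conj a b w
        p+[q-r]-q≡p-r : ∀ p q r → p + (q - r) - q ≡ p - r
        p+[q-r]-q≡p-r = solve-∀

      D-zero-ascent : ∀ {w} → app w a ≢ b → img w a < img w b → D w 0ℤ + D (conj a b w) -1ℤ ≡ 0ℤ
      D-zero-ascent {w} wa≢b wa<wb = begin
        D w 0ℤ + D sws -1ℤ
          ≡⟨ cong₂ (λ p q → p - C w -1ℤ + (q - C sws -[1+ 1 ]))
                   (hecke-ascent s C w wa≢b wa<wb 0ℤ) (hecke-descent s C sws sws-a≢b sws-descent -1ℤ) ⟩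
        C sws 0ℤ - C w -1ℤ + (C (conj a b sws) -1ℤ + (C sws -[1+ 1 ] - C sws 0ℤ) - C sws -[1+ 1 ])
          ≡⟨ cong (λ t → C sws 0ℤ - C w -1ℤ + (C t -1ℤ + (C sws -[1+ 1 ] - C sws 0ℤ) - C sws -[1+ 1 ])) (conj-involutive a b w) ⟩
        C sws 0ℤ - C w -1ℤ + (C w -1ℤ + (C sws -[1+ 1 ] - C sws 0ℤ) - C sws -[1+ 1 ])
          ≡⟨ cancel (C sws 0ℤ) (C w -1ℤ) (C sws -[1+ 1 ]) ⟩
        0ℤ ∎
        where
        open ≡-Reasoning
        sws : Fpf n
        sws = conj a b w
        sws-a≢b : app sws a ≢ b
        sws-a≢b = conj-notFixed s w wa≢b
        sws-descent : Descent sws a b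
        sws-descent = subst₂ _<_ (sym (img-conj-second s w wa≢b)) (sym (img-conj-first s w wa≢b)) wa<wb
        cancel : ∀ p q r → p - q + (q + (r - p) - r) ≡ 0ℤ
        cancel = solve-∀

      D-barInvariant : ψ D ≐ D
      D-barInvariant w k = begin
        ψ D w k                                                                  ≡⟨ ψ-⊖ bar _ _ w k ⟩
        ψ (hecke a b C) w k - ψ (vmul C) w k                                     ≡⟨ cong₂ _-_ (compat a b s C w k) (semilin C w k) ⟩
        hecke a b (ψ C) w k - ψ C w (k - 1ℤ) + ψ C w (k + 1ℤ) - ψ C w (k + 1ℤ)  ≡⟨ [p-q+r]-r≡p-q (hecke a b (ψ C) w k) (ψ C w (k - 1ℤ)) (ψ C w (k + 1ℤ)) ⟩
        hecke a b (ψ C) w k - ψ C w (k - 1ℤ)                                     ≡⟨ cong₂ _-_ (hecke-cong a b (barInvariant y) w k) (barInvariant y w _) ⟩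
        hecke a b C w k - C w (k - 1ℤ)                                           ∎
        where
        open ≡-Reasoning
        [p-q+r]-r≡p-q : ∀ p q r → p - q + r - r ≡ p - q
        [p-q+r]-r≡p-q = solve-∀

      C-lowerBound : ∀ t → ∃[ B ] ∀ m → B ≤ m → C t -[1+ m ] ≡ 0ℤ
      C-lowerBound t with polynomial y t
      ... | B , bound = suc B , λ m B<m → bound -[1+ m ] (ℤ.-<- B<m)

      D-finiteDegrees : FiniteDegrees D
      D-finiteDegrees t with C-lowerBound t | C-lowerBound (conj a b t)
      ... | Bt , C-t | Bst , C-st = 0ℤ ∷ applyUpTo -[1+_] (suc B) , vanish
        where
        B : ℕ
        B = Bt ⊔ Bst
        far : ∀ m → B ≤ m → D t -[1+ suc m ] ≡ 0ℤ
        far m B≤m with position s t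
        ... | fixed ta≡b = D-fixed ta≡b _
        ... | ascent ta≢b ta<tb = cong₂ _-_
          (trans (hecke-ascent s C t ta≢b ta<tb _) (C-st (suc m) (≤-trans (m≤n⊔m Bt Bst) (ℕ.m≤n⇒m≤1+n B≤m))))
          (trans (cong (C t) (ℤ.neg-minus-pos (suc m) 1)) (C-t (suc (suc m)) (≤-trans (m≤m⊔n Bt Bst) (ℕ.m≤n⇒m≤1+n (ℕ.m≤n⇒m≤1+n B≤m)))))
        ... | descent ta≢b tb<ta = begin
          D t k                                                          ≡⟨ cong (_- C t (k - 1ℤ)) (hecke-descent s C t ta≢b tb<ta k) ⟩
          C (conj a b t) k + (C t (k - 1ℤ) - C t (k + 1ℤ)) - C t (k - 1ℤ) ≡⟨ p+[q-r]-q≡p-r (C (conj a b t) k) (C t (k - 1ℤ)) (C t (k + 1ℤ)) ⟩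
          C (conj a b t) k - C t -[1+ m ]                                ≡⟨ cong₂ _-_ (C-st (suc m) (≤-trans (m≤n⊔m Bt Bst) (ℕ.m≤n⇒m≤1+n B≤m)))
                                                                                      (C-t m (≤-trans (m≤m⊔n Bt Bst) B≤m)) ⟩
          0ℤ                                                             ∎
          where
          open ≡-Reasoning
          k : ℤ
          k = -[1+ suc m ]
          p+[q-r]-q≡p-r : ∀ p q r → p + (q - r) - q ≡ p - r
          p+[q-r]-q≡p-r = solve-∀
        vanish : ∀ k → k ∉ 0ℤ ∷ applyUpTo -[1+_] (suc B) → D t k ≡ 0ℤ
        vanish (+ zero)  k∉ = contradiction (here refl) k∉
        vanish (+ suc m) _  = D-pos t m
        vanish -[1+ m ]  k∉ with m ≤? B
        ... | yes m≤B = contradiction (there (∈-applyUpTo⁺ -[1+_] (s≤s m≤B))) k∉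
        ... | no m≰B with ≰⇒> m≰B
        ...   | s≤s B≤m′ = far _ B≤m′

      D-vanishes-from : ∀ N → VanishesAbove N D → ∀ t k → N ≤ len t → D t k ≡ 0ℤ
      D-vanishes-from N above t k N≤t with N ℕ.<? len t
      ... | yes N<t = above t k N<t
      ... | no N≮t  = at-top k
        where
        symmetric : ∀ k → D t k ≡ D t (- k)
        symmetric k = trans (sym (D-barInvariant t k)) (reflected D above D-finiteDegrees t k N≤t)
        at-top : ∀ k → D t k ≡ 0ℤ
        at-top (+ suc m) = D-pos t m
        at-top -[1+ m ]  = trans (symmetric _) (D-pos t m)
        at-top (+ zero) with position s t
        ... | fixed ta≡b         = D-fixed ta≡b _
        ... | descent ta≢b tb<ta = D-zero-descent ta≢b tb<ta
        ... | ascent ta≢b ta<tb  = begin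
          D t 0ℤ                               ≡⟨ ℤ.+-identityʳ _ ⟨
          D t 0ℤ + 0ℤ                          ≡⟨ cong (λ x → D t 0ℤ + x) (above (conj a b t) -1ℤ N<sts) ⟨
          D t 0ℤ + D (conj a b t) -1ℤ          ≡⟨ D-zero-ascent ta≢b ta<tb ⟩
          0ℤ                                   ∎
          where
          open ≡-Reasoning
          N<sts : N < len (conj a b t)
          N<sts = subst (N <_) (sym (len-conj-ascent s t ta≢b ta<tb)) (s≤s (ℕ.≤-trans N≤t (ℕ.n≤1+n _)))

      D-vanishesAbove : ∀ m N → maxLen (allFpf n) ≤ N ℕ.+ m → VanishesAbove N D
      D-vanishesAbove zero    N L≤N   t k N<t = contradiction (≤-trans (len≤maxLen (∈-allFpf t)) (subst (maxLen (allFpf n) ≤_) (ℕ.+-identityʳ N) L≤N)) (<⇒≱ N<t)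
      D-vanishesAbove (suc m) N L≤N+1+m t k N<t =
        D-vanishes-from (suc N) (D-vanishesAbove m (suc N) (subst (maxLen (allFpf n) ≤_) (ℕ.+-suc N m) L≤N+1+m)) t k N<t

      D-vanishes : D ≐ 0ᴹ
      D-vanishes t k = D-vanishes-from 0 (D-vanishesAbove (maxLen (allFpf n)) 0 ≤-refl) t k z≤n

      μ-ascent : ∀ {x} → app x a ≢ b → img x a < img x b → C x -1ℤ ≡ C (conj a b x) 0ℤ
      μ-ascent {x} xa≢b xa<xb =
        sym (ℤ.i-j≡0⇒i≡j _ _ (trans (cong (_- C x -1ℤ) (sym (hecke-ascent s C x xa≢b xa<xb 0ℤ))) (D-vanishes x 0ℤ)))

    μ≢0⇒conj : ∀ {x y : Fpf n} {a b : Fin n} → IsSimple a b → InTau y a b → ¬ InTau x a b → μ cb x y ≢ 0ℤ → x ≡ conj a b y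
    μ≢0⇒conj {x} {y} {a} {b} s y-τ x-notτ μ≢0 with position s x
    ... | fixed xa≡b  = contradiction (Descent⇒InTau s x (fixed⇒Descent s x xa≡b)) x-notτ
    ... | descent _ d = contradiction (Descent⇒InTau s x d) x-notτ
    ... | ascent xa≢b xa<xb with conj a b x ≟ᶠ y
    ...   | yes sxs≡y = trans (sym (conj-involutive a b x)) (cong (conj a b) sxs≡y)
    ...   | no sxs≢y  = contradiction (trans (μ-ascent y s (InTau⇒Descent s y y-τ) xa≢b xa<xb) (C-nonneg y s (InTau⇒Descent s y y-τ) 0 sxs≢y)) μ≢0

    BiEdge⇒conj : ∀ {u v : Fpf n} → BiEdge cb u v → ∃[ a ] ∃[ b ] IsSimple {n} a b × v ≡ conj a b u
    BiEdge⇒conj {u} {v} (_ , (u⊈v , μ+μ≢0) , (v⊈u , _)) with μ cb u v ℤ.≟ 0ℤ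
    ... | no μuv≢0 with ¬TauSub⇒witness v u v⊈u
    ...   | a , b , s , v-d , u-nd = a , b , s , trans (sym (conj-involutive a b v)) (cong (conj a b) (sym u≡svs))
      where
      u≡svs : u ≡ conj a b v
      u≡svs = μ≢0⇒conj s (Descent⇒InTau s v v-d) (u-nd ∘ InTau⇒Descent s u) μuv≢0
    BiEdge⇒conj {u} {v} (_ , (u⊈v , μ+μ≢0) , (v⊈u , _)) | yes μuv≡0 with ¬TauSub⇒witness u v u⊈v
    ...   | a , b , s , u-d , v-nd = a , b , s , μ≢0⇒conj s (Descent⇒InTau s u u-d) (v-nd ∘ InTau⇒Descent s v) μvu≢0
      where
      μvu≢0 : μ cb v u ≢ 0ℤ
      μvu≢0 μvu≡0 = μ+μ≢0 (cong₂ _+_ μuv≡0 μvu≡0)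

open Involutions
open HeckeModule

module _ {n : ℕ} {z0 : Fpf n} (z0-base : IsBase z0) {ψ : Mod n → Mod n} (bar : IsBarInvolution z0 ψ)
         {cb : Fpf n → Mod n} (canonical : IsCanonicalBasis ψ cb) where
  open CanonicalBasis z0-base bar canonical

  nonNesting-BiEdge : {u v : Fpf n} → NonNesting u → BiEdge cb u v → NonNesting v
  nonNesting-BiEdge {u} nonNesting edge@(_ , (u⊈v , _) , _) with BiEdge⇒conj edge
  ... | a , b , s , refl with app u a ≟ b
  ...   | yes ua≡b = subst NonNesting (sym (conj-fixed a b u ua≡b)) nonNesting
  ...   | no ua≢b  = nonNesting-conj u nonNesting s ua≢b (u⊈v ∘ DescentSubset⇒TauSub)

  nonNesting-Star : {u w : Fpf n} → Star (BiEdge cb) u w → NonNesting u → NonNesting w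
  nonNesting-Star ε          nonNesting = nonNesting
  nonNesting-Star (e ◅ path) nonNesting = nonNesting-Star path (nonNesting-BiEdge nonNesting e)

  molecule-nonNesting : {x : Fpf n} → InMolecule cb z0 x → NonNesting x
  molecule-nonNesting x∈C = nonNesting-Star x∈C (base-nonNesting z0 z0-base)

lemmaC1 : (n : ℕ) → 2 ≤ n → 2 ∣ n →
          (z0 : Fpf n) → IsBase z0 →
          (ψ : Mod n → Mod n) → IsBarInvolution z0 ψ →
          (cb : Fpf n → Mod n) → IsCanonicalBasis ψ cb →
          (x : Fpf n) → InMolecule cb z0 x →
          (a b c : Fin n) → IsSimple a b → IsSimple b c →
          ¬ (InTau x a b × InTau x b c)
lemmaC1 n _ _ z0 z0-base ψ bar cb canonical x x∈C a b c ab bc (ab∈τ , bc∈τ) =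
  -- That n is even and positive already follows from IsBase z0.
  nonNesting⇒¬consecutiveDescents x (molecule-nonNesting z0-base bar canonical x∈C) ab bc
    (InTau⇒Descent ab x ab∈τ) (InTau⇒Descent bc x bc∈τ)
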